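{- For every integer $n\geq 1$ and every integer $k\geq 3$, there exists an $n$-vertex outerpath $G$ with the following property: for every set $\mathcal I\subseteq V(G)$ such that the induced subgraph $G[\mathcal I]$ has maximum degree at most $k$, we have $|\mathcal I|\leq \frac{k-1}{k}n+2$.
   Context: Graphs are finite and simple. For $\mathcal I\subseteq V(G)$, $G[\mathcal I]$ is the subgraph induced by $\mathcal I$; the degree of a graph is its maximum vertex degree. An outerplanar graph is a graph admitting a planar drawing with all vertices on the outer face; it is maximal outerplanar if no edge can be added keeping it simple and outerplanar. A maximal outerplanar graph has an essentially unique outerplanar embedding whose internal faces are triangles; its weak dual is the graph with one vertex per internal face, two being adjacent when the faces share an edge. A maximal outerpath is a maximal outerplanar graph whose weak dual is a path, and an outerpath is a subgraph of a maximal outerpath. -}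

module Defs where

open import Data.Nat using (ℕ; suc; _≤_; _*_; _+_; _∸_)
open import Data.Fin using (Fin; toℕ; _<_)
open import Data.Fin.Subset using (Subset; _∈_; _∩_; ∣_∣)
open import Data.Bool using (Bool; true; false; _∨_; T)
open import Data.Vec using (tabulate)
open import Data.Product using (Σ; ∃; _×_; _,_)
open import Data.Sum using (_⊎_)
open import Data.Empty using (⊥)
open import Relation.Nullary using (¬_)
open import Relation.Binary.PropositionalEquality using (_≡_; _≢_)
open import Function.Definitions using (Injective)
open import Data.Fin.Properties using (_≟_)
open import Relation.Nullary.Decidable using (⌊_⌋)

record Graph (n : ℕ) : Set where
  field
    adj   : Fin n → Fin n → Bool
    sym   : ∀ u v → adj u v ≡ adj v u
    irrefl : ∀ v → adj v v ≡ false
open Graph public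

Edge : ∀ {n} → Graph n → Fin n → Fin n → Set
Edge G u v = adj G u v ≡ true

nbhd : ∀ {n} → Graph n → Fin n → Subset n
nbhd G v = tabulate (adj G v)

InducedMaxDegree≤ : ∀ {n} → Graph n → Subset n → ℕ → Set
InducedMaxDegree≤ G I k = ∀ v → v ∈ I → ∣ nbhd G v ∩ I ∣ ≤ k

addEdge : ∀ {n} (G : Graph n) (u v : Fin n) → u ≢ v → Graph n
addEdge {n} G u v u≢v = record
  { adj = λ a b → adj G a b ∨ (is a b u v ∨ is a b v u)
  ; sym = symm
  ; irrefl = irr }
  where
  open import Data.Bool using (_∧_)
  open import Relation.Binary.PropositionalEquality using (refl; cong₂; sym; trans; subst)
  open import Relation.Nullary using (yes; no)
  open import Data.Bool.Properties using (∨-comm)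
  is : Fin n → Fin n → Fin n → Fin n → Bool
  is a b x y = ⌊ a ≟ x ⌋ ∧ ⌊ b ≟ y ⌋
  symm : ∀ a b → (adj G a b ∨ (is a b u v ∨ is a b v u)) ≡ (adj G b a ∨ (is b a u v ∨ is b a v u))
  symm a b with a ≟ u | a ≟ v | b ≟ u | b ≟ v
  ... | x1 | x2 | x3 | x4 = cong₂ _∨_ (Graph.sym G a b) (lem x1 x2 x3 x4)
    where
    open import Relation.Nullary using (Dec)
    lem : ∀ (x1 : Dec (a ≡ u)) (x2 : Dec (a ≡ v)) (x3 : Dec (b ≡ u)) (x4 : Dec (b ≡ v)) →
          (⌊ x1 ⌋ ∧ ⌊ x4 ⌋ ∨ ⌊ x2 ⌋ ∧ ⌊ x3 ⌋) ≡ (⌊ x3 ⌋ ∧ ⌊ x2 ⌋ ∨ ⌊ x4 ⌋ ∧ ⌊ x1 ⌋)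
    lem (yes _) (yes _) (yes _) (yes _) = refl
    lem (yes _) (yes _) (yes _) (no _) = refl
    lem (yes _) (yes _) (no _) (yes _) = refl
    lem (yes _) (yes _) (no _) (no _) = refl
    lem (yes _) (no _) (yes _) (yes _) = refl
    lem (yes _) (no _) (yes _) (no _) = refl
    lem (yes _) (no _) (no _) (yes _) = refl
    lem (yes _) (no _) (no _) (no _) = refl
    lem (no _) (yes _) (yes _) (yes _) = refl
    lem (no _) (yes _) (yes _) (no _) = refl
    lem (no _) (yes _) (no _) (yes _) = refl
    lem (no _) (yes _) (no _) (no _) = refl
    lem (no _) (no _) (yes _) (yes _) = refl
    lem (no _) (no _) (yes _) (no _) = refl
    lem (no _) (no _) (no _) (yes _) = refl
    lem (no _) (no _) (no _) (no _) = refl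
  irr : ∀ a → (adj G a a ∨ (is a a u v ∨ is a a v u)) ≡ false
  irr a with Graph.irrefl G a
  ... | e rewrite e with a ≟ u | a ≟ v
  ... | yes refl | yes refl = Data.Empty.⊥-elim (u≢v refl) where import Data.Empty
  ... | yes _ | no _ = refl
  ... | no _ | yes _ = refl
  ... | no _ | no _ = refl

-- Outerplanarity, combinatorially: the vertices can be placed in a cyclic
-- order (a permutation pos of positions 0..n-1 around a circle) so that no
-- two edges cross, i.e. there are no edges ab, cd whose endpoints interleave
-- pos a < pos c < pos b < pos d.
Outerplanar : ∀ {n} → Graph n → Set
Outerplanar {n} G =
  Σ (Fin n → Fin n) λ pos → Injective _≡_ _≡_ pos ×
    (∀ a b c d → Edge G a b → Edge G c d →
       ¬ (pos a < pos c × pos c < pos b × pos b < pos d))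

MaximalOuterplanar : ∀ {n} → Graph n → Set
MaximalOuterplanar G =
  Outerplanar G ×
  (∀ u v (u≢v : u ≢ v) → adj G u v ≡ false → ¬ Outerplanar (addEdge G u v u≢v))

Triple : ℕ → Set
Triple n = Fin n × Fin n × Fin n

IsTriangle : ∀ {n} → Graph n → Triple n → Set
IsTriangle G (a , b , c) = a < b × b < c × Edge G a b × Edge G b c × Edge G a c

_∈t_ : ∀ {n} → Fin n → Triple n → Set
x ∈t (a , b , c) = x ≡ a ⊎ x ≡ b ⊎ x ≡ c

-- Two (triangular) faces are adjacent in the weak dual iff they share an edge,
-- i.e. two distinct vertices.
ShareEdge : ∀ {n} → Triple n → Triple n → Set
ShareEdge t t' = Σ _ λ u → Σ _ λ v → u ≢ v × u ∈t t × v ∈t t × u ∈t t' × v ∈t t'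

-- The weak dual of G is a path: its vertices (the internal faces, i.e. the
-- triangles of the maximal outerplanar graph G) can be listed without
-- repetition as f 0, …, f (m-1), exhausting all of them, so that two of
-- them are adjacent iff their indices are consecutive.
WeakDualIsPath : ∀ {n} → Graph n → Set
WeakDualIsPath {n} G =
  Σ ℕ λ m → Σ (Fin m → Triple n) λ f →
    Injective _≡_ _≡_ f ×
    (∀ i → IsTriangle G (f i)) ×
    (∀ t → IsTriangle G t → ∃ λ i → f i ≡ t) ×
    (∀ i j → i ≢ j → (ShareEdge (f i) (f j) → (suc (toℕ i) ≡ toℕ j ⊎ suc (toℕ j) ≡ toℕ i))
           × ((suc (toℕ i) ≡ toℕ j ⊎ suc (toℕ j) ≡ toℕ i) → ShareEdge (f i) (f j)))

MaximalOuterpath : ∀ {n} → Graph n → Set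
MaximalOuterpath G = MaximalOuterplanar G × WeakDualIsPath G

-- An outerpath: a subgraph of a maximal outerpath, i.e. there is a maximal
-- outerpath H and an injective vertex map G → H sending edges to edges.
Outerpath : ∀ {n} → Graph n → Set
Outerpath {n} G =
  Σ ℕ λ m → Σ (Graph m) λ H → MaximalOuterpath H ×
    Σ (Fin n → Fin m) λ φ → Injective _≡_ _≡_ φ ×
      (∀ u v → Edge G u v → Edge H (φ u) (φ v))

-- The graph is a polygon triangulated by a sweep: a diagonal starts at the edge
-- between the first and the last vertex and moves one step at a time, along the
-- bottom side in blocks of k steps alternating with blocks of k steps along the
-- top side.  The triangles come in sweep order, so the weak dual is a path, and
-- the graph is maximal since every non-edge crosses a diagonal, while two
-- crossing chords of a Hamiltonian cycle cannot be drawn without crossing (a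
-- parity argument along the arcs of the cycle).
--
-- List the vertices in the order in which the sweep reaches them and cut the
-- list into blocks of k.  The first vertex of a block is the hub of a fan: it is
-- adjacent to the rest of its block, to two vertices of the previous block and
-- to two of the next.  If a whole block lies in I, the degree bound forces one
-- of these two pairs out of I, and a discharging argument along the blocks
-- yields a vertex outside I per block, that is about n / k of them.

module Submission where

open import Data.Bool.Base using (Bool; true; false; not; _∧_; _xor_; if_then_else_)
open import Data.Bool.Properties using (xor-same; xor-comm; ∨-zeroʳ) renaming (_≟_ to _≟ᵇ_)
open import Data.Empty using (⊥; ⊥-elim)
open import Data.Fin.Base as Fin using (Fin; toℕ; fromℕ<)
open import Data.Fin.Properties using (toℕ-injective; toℕ-fromℕ<; toℕ<n) renaming (_≟_ to _≟ᶠ_)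
open import Data.Fin.Subset using (Subset; _∈_; _∩_; ∁; ∣_∣)
open import Data.Fin.Subset.Properties
  using (x∈p⇒∣p-x∣<∣p∣; x∈p∧x≢y⇒x∈p-y; x∈p∩q⁺; _∈?_; x∉∁p⇒x∈p; ∣p∣≤n; ∣∁p∣≡n∸∣p∣)
open import Data.List.Base using (List; []; _∷_; length; applyUpTo; filter)
open import Data.List.Properties using (length-applyUpTo)
open import Data.List.Relation.Unary.All as All using (All; []; _∷_)
open import Data.List.Relation.Unary.All.Properties using (applyUpTo⁺₁; all-filter)
open import Data.List.Relation.Unary.AllPairs using ([]; _∷_)
open import Data.List.Relation.Unary.Unique.Propositional using (Unique)
import Data.List.Relation.Unary.Unique.Propositional.Properties as Unique
open import Data.Nat.Base
open import Data.Nat.DivMod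
  using (_mod_; _/_; _%_; m%n<n; m<n⇒m%n≡m; m≤n⇒[n∸m]%m≡n%m; [m+n]%n≡m%n; m≡m%n+[m/n]*n; [m+kn]%n≡m%n;
         n%n≡0; +-distrib-/-∣ˡ; m*n/n≡m; m<n⇒m/n≡0; m/n*n≤m)
open import Data.Nat.Divisibility using (n∣m*n)
open import Data.Nat.Properties
open import Data.Nat.Tactic.RingSolver using (solve-∀)
open import Data.Product.Base using (Σ; ∃; _×_; _,_; proj₁; proj₂)
open import Data.Sum.Base using (_⊎_; inj₁; inj₂)
open import Data.Vec.Properties using (lookup∘tabulate; lookup⇒[]=)
open import Function.Base using (_∘_; id)
open import Relation.Binary.Definitions using (Tri; tri<; tri≈; tri>)
open import Relation.Binary.PropositionalEquality hiding (J)
open import Relation.Nullary.Decidable using (Dec; yes; no; does; from-yes; dec-true; dec-false; _×-dec_; _⊎-dec_)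
open import Relation.Nullary.Negation.Core using (¬_; contradiction)
open import Relation.Nullary.Reflects using (Reflects; ofʸ; ofⁿ)
open import Defs hiding (sym)

-- Counting along a 0/1 sequence

ind : Bool → ℕ
ind true  = 1
ind false = 0

ind≤1 : ∀ x → ind x ≤ 1
ind≤1 true  = ≤-refl
ind≤1 false = z≤n

ind-∧≤ˡ : ∀ x y → ind (x ∧ y) ≤ ind x
ind-∧≤ˡ true  y = ind≤1 y
ind-∧≤ˡ false y = z≤n

count : (ℕ → Bool) → ℕ → ℕ
count b zero    = 0
count b (suc l) = ind (b 0) + count (b ∘ suc) l

count-+ : ∀ b l₁ l₂ → count b (l₁ + l₂) ≡ count b l₁ + count (b ∘ (l₁ +_)) l₂
count-+ b zero     l₂ = refl
count-+ b (suc l₁) l₂ =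
  trans (cong (ind (b 0) +_) (count-+ (b ∘ suc) l₁ l₂)) (sym (+-assoc (ind (b 0)) _ _))

count-snoc : ∀ b l → count b (suc l) ≡ count b l + ind (b l)
count-snoc b l = trans (cong (count b) (+-comm 1 l))
                       (trans (count-+ b l 1)
                              (cong (count b l +_) (trans (+-identityʳ _) (cong (ind ∘ b) (+-identityʳ l)))))

count≤length : ∀ b l → count b l ≤ l
count≤length b zero    = z≤n
count≤length b (suc l) = +-mono-≤ (ind≤1 (b 0)) (count≤length (b ∘ suc) l)

count+count-not : ∀ b l → count b l + count (not ∘ b) l ≡ l
count+count-not b zero = refl
count+count-not b (suc l) with b 0
... | true  = cong suc (count+count-not (b ∘ suc) l)
... | false = trans (+-suc (count (b ∘ suc) l) _) (cong suc (count+count-not (b ∘ suc) l))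

count-+≤ : ∀ b s d → count b (s + d) ≤ count b s + d
count-+≤ b s d = subst (_≤ count b s + d) (sym (count-+ b s d))
                       (+-monoʳ-≤ (count b s) (count≤length (b ∘ (s +_)) d))

count-mono : ∀ b {s s'} → s ≤ s' → count b s ≤ count b s'
count-mono b {s} {s'} s≤s' = subst (λ u → count b s ≤ count b u) (m+[n∸m]≡n s≤s')
  (subst (count b s ≤_) (sym (count-+ b s (s' ∸ s))) (m≤m+n (count b s) _))

count-intermediate : ∀ b N t → t ≤ count b N → ∃ λ s → s ≤ N × count b s ≡ t
count-intermediate b zero    zero    _  = 0 , z≤n , refl
count-intermediate b (suc N) t t≤ with t ≤? count b N
... | yes t≤' with s , s≤N , e ← count-intermediate b N t t≤' = s , m≤n⇒m≤1+n s≤N , e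
... | no t≰ = suc N , ≤-refl , ≤-antisym (≤-trans step (≰⇒> t≰)) t≤
  where
  step : count b (suc N) ≤ suc (count b N)
  step = subst₂ (λ u v → count b u ≤ v) (+-comm N 1) (+-comm (count b N) 1) (count-+≤ b N 1)

-- Applied to i = I s and j = J s below, this says that the diagonals of a sweep do not cross.
count-chain : ∀ b {i j i' j'} → count b (i + j) ≡ i → count b (i' + j') ≡ i' → i < i' → j' < j → ⊥
count-chain b {i} {j} {i'} {j'} e e' i<i' j'<j with i + j ≤? i' + j'
... | no  i+j≰ = <⇒≱ i<i' (subst₂ _≤_ e' e (count-mono b (<⇒≤ (≰⇒> i+j≰))))
... | yes i+j≤ = <⇒≱ j'<j (+-cancelˡ-≤ i' j j' (begin
    i' + j          ≤⟨ +-monoˡ-≤ j i'≤i+d ⟩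
    i + d + j       ≡⟨ +-assoc i d j ⟩
    i + (d + j)     ≡⟨ cong (i +_) (+-comm d j) ⟩
    i + (j + d)     ≡⟨ +-assoc i j d ⟨
    i + j + d       ≡⟨ m+[n∸m]≡n i+j≤ ⟩
    i' + j'         ∎))
  where
  open ≤-Reasoning
  d : ℕ
  d = i' + j' ∸ (i + j)
  i'≤i+d : i' ≤ i + d
  i'≤i+d = subst₂ _≤_ (trans (cong (count b) (m+[n∸m]≡n i+j≤)) e') (cong (_+ d) e) (count-+≤ b (i + j) d)

count-last : ∀ b l → ind (b l) ≤ count b (suc l)
count-last b l = subst (ind (b l) ≤_) (sym (count-snoc b l)) (m≤n+m (ind (b l)) (count b l))

count≡0⇒false : ∀ b {l r} → count b l ≡ 0 → r < l → b r ≡ false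
count≡0⇒false b {suc l} {zero}  eq _ with b 0
... | false = refl
count≡0⇒false b {suc l} {suc r} eq (s≤s r<l) with b 0
... | false = count≡0⇒false (b ∘ suc) eq r<l

count-first-second-last : ∀ b {K} → 3 ≤ K → ind (b 0) + ind (b 1) + ind (b (K ∸ 1)) ≤ count b K
count-first-second-last b (s≤s (s≤s (s≤s {n = l} _))) =
  subst (_≤ count b (3 + l)) (sym (+-assoc (ind (b 0)) (ind (b 1)) _))
    (+-monoʳ-≤ (ind (b 0)) (+-monoʳ-≤ (ind (b 1)) (count-last (b ∘ suc ∘ suc) l)))

module Blocks (K : ℕ) (b : ℕ → Bool) (b₀ : Bool) where

  block : ℕ → ℕ
  block i = count (b ∘ (i * K +_)) K

  startPair : ℕ → Bool
  startPair i = b (i * K) ∧ b (i * K + 1)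

  leftPair : ℕ → Bool
  leftPair zero    = b₀
  leftPair (suc i) = b (i * K) ∧ b (i * K + (K ∸ 1))

  rightPair : ℕ → Bool
  rightPair i = startPair (suc i)

  Flanked : ℕ → Set
  Flanked i = block i ≡ 0 → leftPair i ≡ true ⊎ rightPair i ≡ true

  count-blocks : ∀ i → count b (suc i * K) ≡ count b (i * K) + block i
  count-blocks i = trans (cong (count b) (+-comm K (i * K))) (count-+ b (i * K) K)

  -- Discharging: an empty block takes one unit from a neighbouring pair, and
  -- since K ≥ 3 a block containing such a pair has a spare unit to give.
  module _ (3≤K : 3 ≤ K) where

    pairs≤block : ∀ i → 1 ≤ block i → 1 + ind (startPair i) + ind (leftPair (suc i)) ≤ block i
    pairs≤block i 1≤m with b (i * K) in eq
    ... | false = subst (_≤ block i) (sym (+-identityʳ 1)) 1≤m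
    ... | true  = subst (_≤ block i) (cong (λ u → ind u + ind (b (i * K + 1)) + ind (b (i * K + (K ∸ 1)))) first)
                    (count-first-second-last (b ∘ (i * K +_)) 3≤K)
      where
      first : b (i * K + 0) ≡ true
      first = trans (cong b (+-identityʳ (i * K))) eq

    emptyHead : ∀ i → block i ≡ 0 → b (i * K) ≡ false
    emptyHead i e = subst (λ u → b u ≡ false) (+-identityʳ (i * K))
                          (count≡0⇒false (b ∘ (i * K +_)) e (≤-trans (s≤s z≤n) 3≤K))

    emptyStep : ∀ {i c L S'} → (L ≡ true ⊎ S' ≡ true) → i + ind L ≤ c → suc i + 0 ≤ c + ind S'
    emptyStep {i} {c} (inj₁ refl) inv =
      ≤-trans (≤-reflexive (trans (+-identityʳ (suc i)) (+-comm 1 i))) (≤-trans inv (m≤m+n c _))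
    emptyStep {i} {c} {L} (inj₂ refl) inv =
      subst₂ _≤_ (sym (+-identityʳ (suc i))) (+-comm 1 c) (s≤s (≤-trans (m≤m+n i (ind L)) inv))

    nonEmptyStep : ∀ {i c m L S L' S'} → 1 + ind S + ind L' ≤ m → i + ind L ≤ c + ind S →
                   suc i + ind L' ≤ c + m + ind S'
    nonEmptyStep {i} {c} {m} {L} {S} {L'} {S'} pairs inv = begin
      suc i + ind L'              ≤⟨ +-monoˡ-≤ (ind L') (s≤s (≤-trans (m≤m+n i (ind L)) inv)) ⟩
      suc (c + ind S) + ind L'    ≡⟨ cong (_+ ind L') (+-suc c (ind S)) ⟨
      c + (1 + ind S) + ind L'    ≡⟨ +-assoc c (1 + ind S) (ind L') ⟩
      c + (1 + ind S + ind L')    ≤⟨ +-monoʳ-≤ c pairs ⟩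
      c + m                       ≤⟨ m≤m+n (c + m) (ind S') ⟩
      c + m + ind S'              ∎
      where open ≤-Reasoning

    Invariant : ℕ → Set
    Invariant i = i + ind (leftPair i) ≤ ind b₀ + count b (i * K) + ind (startPair i)

    invariant-step : ∀ i → Flanked i → Invariant i → Invariant (suc i)
    invariant-step i hyp inv =
      subst (λ u → suc i + ind (leftPair (suc i)) ≤ u + ind (rightPair i)) (sym total) (extend (block i) refl)
      where
      c : ℕ
      c = ind b₀ + count b (i * K)
      total : ind b₀ + count b (suc i * K) ≡ c + block i
      total = trans (cong (ind b₀ +_) (count-blocks i)) (sym (+-assoc (ind b₀) _ _))
      extend : ∀ m → block i ≡ m → suc i + ind (leftPair (suc i)) ≤ c + m + ind (rightPair i)
      extend zero e =
        subst (λ u → suc i + ind (u ∧ b (i * K + (K ∸ 1))) ≤ c + 0 + ind (rightPair i)) (sym (emptyHead i e))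
          (emptyStep {i} {c + 0} {leftPair i} {rightPair i} (hyp e)
            (subst (λ u → i + ind (leftPair i) ≤ c + ind (u ∧ b (i * K + 1))) (emptyHead i e) inv))
      extend (suc m) e =
        nonEmptyStep {i} {c} {suc m} {leftPair i} {startPair i} {leftPair (suc i)} {rightPair i}
          (subst (1 + ind (startPair i) + ind (leftPair (suc i)) ≤_) e (pairs≤block i (subst (1 ≤_) (sym e) z<s)))
          inv

    invariant : ∀ G → (∀ i → i < G → Flanked i) → Invariant G
    invariant zero    _   = ≤-trans (m≤m+n (ind b₀) 0) (m≤m+n _ _)
    invariant (suc i) hyp = invariant-step i (hyp i ≤-refl) (invariant i (λ j j<i → hyp j (m<n⇒m<1+n j<i)))

    blocks≤count : ∀ G → (∀ i → i < G → Flanked i) → G ≤ ind b₀ + count b (suc (G * K))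
    blocks≤count G hyp = begin
      G                                             ≤⟨ m≤m+n G _ ⟩
      G + ind (leftPair G)                          ≤⟨ invariant G hyp ⟩
      ind b₀ + count b (G * K) + ind (startPair G)  ≤⟨ +-monoʳ-≤ (ind b₀ + count b (G * K)) (ind-∧≤ˡ _ _) ⟩
      ind b₀ + count b (G * K) + ind (b (G * K))    ≡⟨ +-assoc (ind b₀) _ _ ⟩
      ind b₀ + (count b (G * K) + ind (b (G * K)))  ≡⟨ cong (ind b₀ +_) (count-snoc b (G * K)) ⟨
      ind b₀ + count b (suc (G * K))                ∎
      where open ≤-Reasoning

-- Outerplanar drawings

∀-Bool? : {P : Bool → Set} → (∀ b → Dec (P b)) → Dec (∀ b → P b)
∀-Bool? P? with P? false | P? true
... | yes f | yes t = yes λ { false → f ; true → t }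
... | no ¬f | _     = no λ h → ¬f (h false)
... | yes _ | no ¬t = no λ h → ¬t (h true)

Edge-sym : ∀ {n} (G : Graph n) {u v} → Edge G u v → Edge G v u
Edge-sym G {u} {v} e = trans (Graph.sym G v u) e

Edge⇒≢ : ∀ {n} (G : Graph n) {u v} → Edge G u v → u ≢ v
Edge⇒≢ G {u} e refl with () ← trans (sym e) (Graph.irrefl G u)

xor-cocycle : ∀ a b c d e f → ((a xor b) xor (c xor d)) xor ((b xor e) xor (d xor f)) ≡ (a xor e) xor (c xor f)
xor-cocycle = from-yes
  (∀-Bool? λ a → ∀-Bool? λ b → ∀-Bool? λ c → ∀-Bool? λ d → ∀-Bool? λ e → ∀-Bool? λ f →
   ((a xor b) xor (c xor d)) xor ((b xor e) xor (d xor f)) ≟ᵇ (a xor e) xor (c xor f))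

xor-threePairings : ∀ ab ac ad bc bd cd →
  ((ab xor not bc) xor (ad xor cd)) xor ((ac xor bc) xor (ad xor bd)) xor ((bd xor cd) xor (not ab xor not ac)) ≡ true
xor-threePairings = from-yes
  (∀-Bool? λ ab → ∀-Bool? λ ac → ∀-Bool? λ ad → ∀-Bool? λ bc → ∀-Bool? λ bd → ∀-Bool? λ cd →
   ((ab xor not bc) xor (ad xor cd)) xor ((ac xor bc) xor (ad xor bd)) xor ((bd xor cd) xor (not ab xor not ac))
     ≟ᵇ true)

module Drawing {n} (G : Graph n) (op : Outerplanar G) where

  pos : Fin n → ℕ
  pos x = toℕ (proj₁ op x)

  pos-injective : ∀ {x y} → pos x ≡ pos y → x ≡ y
  pos-injective e = proj₁ (proj₂ op) (toℕ-injective e)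

  noCrossing : ∀ {a b c d} → Edge G a b → Edge G c d → ¬ (pos a < pos c × pos c < pos b × pos b < pos d)
  noCrossing = proj₂ (proj₂ op) _ _ _ _

  before : Fin n → Fin n → Bool
  before x y = pos x <ᵇ pos y

  before-reflects : ∀ x y → Reflects (pos x < pos y) (before x y)
  before-reflects x y = <ᵇ-reflects-< (pos x) (pos y)

  -- For w ∉ {y, z}: whether w lies strictly between y and z in the drawing.
  inside : Fin n → Fin n → Fin n → Bool
  inside y z w = before y w xor before z w

  separates : Fin n → Fin n → Fin n → Fin n → Bool
  separates y z w x = inside y z w xor inside y z x

  before-flip : ∀ {x y} → x ≢ y → before y x ≡ not (before x y)
  before-flip {x} {y} x≢y with before x y | before-reflects x y | before y x | before-reflects y x
  ... | true  | ofʸ x<y | true  | ofʸ y<x = contradiction x<y (<-asym y<x)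
  ... | true  | _       | false | _       = refl
  ... | false | _       | true  | _       = refl
  ... | false | ofⁿ x≮y | false | ofⁿ y≮x =
    contradiction (pos-injective (≤-antisym (≮⇒≥ y≮x) (≮⇒≥ x≮y))) x≢y

  inside-sym : ∀ y z w → inside y z w ≡ inside z y w
  inside-sym y z w = xor-comm (before y w) (before z w)

  inside⇒between : ∀ {y z w} → pos y < pos z → w ≢ z → inside y z w ≡ true → pos y < pos w × pos w < pos z
  inside⇒between {y} {z} {w} y<z w≢z h with before y w | before-reflects y w | before z w | before-reflects z w
  ... | true  | ofʸ y<w | false | ofⁿ z≮w = y<w , ≤∧≢⇒< (≮⇒≥ z≮w) (λ e → w≢z (pos-injective e))
  ... | false | ofⁿ y≮w | true  | ofʸ z<w = contradiction (<-trans y<z z<w) y≮w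

  outside⇒beyond : ∀ {y z x} → pos y < pos z → x ≢ y → inside y z x ≡ false → pos x < pos y ⊎ pos z < pos x
  outside⇒beyond {y} {z} {x} y<z x≢y h with before y x | before-reflects y x | before z x | before-reflects z x
  ... | true  | _       | true  | ofʸ z<x = inj₂ z<x
  ... | false | ofⁿ y≮x | false | _       = inj₁ (≤∧≢⇒< (≮⇒≥ y≮x) (λ e → x≢y (pos-injective e)))

  private
    crossing : ∀ {y z w x} → Edge G y z → Edge G w x → pos y < pos z → w ≢ z → x ≢ y →
               inside y z w ≡ true → inside y z x ≡ false → ⊥
    crossing eyz ewx y<z w≢z x≢y hw hx with inside⇒between y<z w≢z hw | outside⇒beyond y<z x≢y hx
    ... | y<w , w<z | inj₂ z<x = noCrossing eyz ewx (y<w , w<z , z<x)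
    ... | y<w , w<z | inj₁ x<y = noCrossing (Edge-sym G ewx) eyz (x<y , y<w , w<z)

    sameSide-oriented : ∀ {y z w x} → Edge G y z → Edge G w x → pos y < pos z →
                        w ≢ y → w ≢ z → x ≢ y → x ≢ z → inside y z w ≡ inside y z x
    sameSide-oriented {y} {z} {w} {x} eyz ewx y<z w≢y w≢z x≢y x≢z with inside y z w in hw | inside y z x in hx
    ... | true  | true  = refl
    ... | false | false = refl
    ... | true  | false = ⊥-elim (crossing eyz ewx y<z w≢z x≢y hw hx)
    ... | false | true  = ⊥-elim (crossing eyz (Edge-sym G ewx) y<z x≢z w≢y hx hw)

  edge-sameSide : ∀ {y z w x} → Edge G y z → Edge G w x → w ≢ y → w ≢ z → x ≢ y → x ≢ z →
                  inside y z w ≡ inside y z x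
  edge-sameSide {y} {z} {w} {x} eyz ewx w≢y w≢z x≢y x≢z with <-cmp (pos y) (pos z)
  ... | tri< y<z _ _ = sameSide-oriented eyz ewx y<z w≢y w≢z x≢y x≢z
  ... | tri≈ _ e _   = contradiction (pos-injective e) (Edge⇒≢ G eyz)
  ... | tri> _ _ z<y = begin
    inside y z w  ≡⟨ inside-sym y z w ⟩
    inside z y w  ≡⟨ sameSide-oriented (Edge-sym G eyz) ewx z<y w≢z w≢y x≢z x≢y ⟩
    inside z y x  ≡⟨ inside-sym z y x ⟩
    inside y z x  ∎
    where open ≡-Reasoning

  Path : (ℕ → Fin n) → ℕ → Set
  Path Q L = ∀ i → i < L → Edge G (Q i) (Q (suc i))

  path-sameSide : ∀ {y z} (Q : ℕ → Fin n) L → Edge G y z → Path Q L →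
                  (∀ i → i ≤ L → Q i ≢ y × Q i ≢ z) → inside y z (Q 0) ≡ inside y z (Q L)
  path-sameSide Q zero    eyz q avoid = refl
  path-sameSide Q (suc L) eyz q avoid =
    trans (edge-sameSide eyz (q 0 z<s) (proj₁ (avoid 0 z≤n)) (proj₂ (avoid 0 z≤n))
                                       (proj₁ (avoid 1 (s≤s z≤n))) (proj₂ (avoid 1 (s≤s z≤n))))
          (path-sameSide (Q ∘ suc) L eyz (λ i i<L → q (suc i) (s≤s i<L)) (λ i i≤L → avoid (suc i) (s≤s i≤L)))

  separates-cocycle : ∀ y z t w x → separates y z w x xor separates z t w x ≡ separates y t w x
  separates-cocycle y z t w x =
    xor-cocycle (before y w) (before z w) (before y x) (before z x) (before t w) (before t x)

  separates-refl : ∀ y w x → separates y y w x ≡ false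
  separates-refl y w x = cong₂ _xor_ (xor-same (before y w)) (xor-same (before y x))

  disjointPaths-separate : ∀ (P : ℕ → Fin n) L (Q : ℕ → Fin n) L' → Path P L → Path Q L' →
                           (∀ i j → i ≤ L → j ≤ L' → P i ≢ Q j) →
                           separates (P 0) (P L) (Q 0) (Q L') ≡ false
  disjointPaths-separate P zero    Q L' p q disjoint = separates-refl (P 0) (Q 0) (Q L')
  disjointPaths-separate P (suc L) Q L' p q disjoint = begin
    separates (P 0) (P (suc L)) (Q 0) (Q L')
      ≡⟨ separates-cocycle (P 0) (P 1) (P (suc L)) (Q 0) (Q L') ⟨
    separates (P 0) (P 1) (Q 0) (Q L') xor separates (P 1) (P (suc L)) (Q 0) (Q L')
      ≡⟨ cong₂ _xor_ first rest ⟩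
    false ∎
    where
    open ≡-Reasoning
    first : separates (P 0) (P 1) (Q 0) (Q L') ≡ false
    first = trans (cong (_xor inside (P 0) (P 1) (Q L'))
                        (path-sameSide Q L' (p 0 z<s) q
                          (λ j j≤L' → (λ e → disjoint 0 j z≤n j≤L' (sym e)) ,
                                      (λ e → disjoint 1 j (s≤s z≤n) j≤L' (sym e)))))
                  (xor-same (inside (P 0) (P 1) (Q L')))
    rest : separates (P 1) (P (suc L)) (Q 0) (Q L') ≡ false
    rest = disjointPaths-separate (P ∘ suc) L Q L' (λ i i<L → p (suc i) (s≤s i<L)) q
             (λ i j i≤L j≤L' → disjoint (suc i) j (s≤s i≤L) j≤L')

  -- Of the three ways to split four points of a line into two pairs, exactly one interleaves.
  threePairings : ∀ {a b c d} → a ≢ b → a ≢ c → b ≢ c →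
                  separates a c b d xor separates a b c d xor separates b c d a ≡ true
  threePairings {a} {b} {c} {d} a≢b a≢c b≢c
    rewrite before-flip a≢b | before-flip a≢c | before-flip b≢c =
    xor-threePairings (before a b) (before a c) (before a d) (before b c) (before b d) (before c d)

toℕ-mod : ∀ x n .{{_ : NonZero n}} → toℕ (x mod n) ≡ x % n
toℕ-mod x n = toℕ-fromℕ< (m%n<n x n)

module HamiltonianCycle {n} .{{_ : NonZero n}} (G : Graph n) (op : Outerplanar G)
                        (cycle : ∀ x → Edge G (x mod n) (suc x mod n)) where
  open Drawing G op

  mod-cong : ∀ {x y} → x % n ≡ y % n → x mod n ≡ y mod n
  mod-cong {x} {y} e = toℕ-injective (trans (toℕ-mod x n) (trans e (sym (toℕ-mod y n))))

  mod⇒% : ∀ {x y} → x mod n ≡ y mod n → x % n ≡ y % n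
  mod⇒% {x} {y} e = trans (sym (toℕ-mod x n)) (trans (cong toℕ e) (toℕ-mod y n))

  mod-distinct : ∀ {x y} → x < n → x < y → y < n + x → x mod n ≢ y mod n
  mod-distinct {x} {y} x<n x<y y<n+x e with y <? n
  ... | yes y<n = <⇒≢ x<y (begin
    x       ≡⟨ m<n⇒m%n≡m x<n ⟨
    x % n   ≡⟨ mod⇒% e ⟩
    y % n   ≡⟨ m<n⇒m%n≡m y<n ⟩
    y       ∎)
    where open ≡-Reasoning
  ... | no y≮n  = <⇒≢ y∸n<x (begin
    y ∸ n        ≡⟨ m<n⇒m%n≡m (<-trans y∸n<x x<n) ⟨
    (y ∸ n) % n  ≡⟨ m≤n⇒[n∸m]%m≡n%m (≮⇒≥ y≮n) ⟩
    y % n        ≡⟨ mod⇒% e ⟨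
    x % n        ≡⟨ m<n⇒m%n≡m x<n ⟩
    x            ∎)
    where
    open ≡-Reasoning
    y∸n<x : y ∸ n < x
    y∸n<x = subst (y ∸ n <_) (m+n∸m≡n n x) (∸-monoˡ-< y<n+x (≮⇒≥ y≮n))

  arc : ℕ → ℕ → Fin n
  arc u j = (u + j) mod n

  arc-path : ∀ u l → Path (arc u) l
  arc-path u l j _ = subst (λ v → Edge G ((u + j) mod n) (v mod n)) (sym (+-suc u j)) (cycle (u + j))

  arcs-separate : ∀ {u v w x} → u ≤ v → v < w → w ≤ x → x < n + u → v < n →
                  separates (u mod n) (v mod n) (w mod n) (x mod n) ≡ false
  arcs-separate {u} {v} {w} {x} u≤v v<w w≤x x<n+u v<n = begin
    separates (u mod n) (v mod n) (w mod n) (x mod n)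
      ≡⟨ cong₂ (λ y z → separates y z (w mod n) (x mod n)) (start u) (end u≤v) ⟨
    separates (arc u 0) (arc u (v ∸ u)) (w mod n) (x mod n)
      ≡⟨ cong₂ (separates (arc u 0) (arc u (v ∸ u))) (start w) (end w≤x) ⟨
    separates (arc u 0) (arc u (v ∸ u)) (arc w 0) (arc w (x ∸ w))
      ≡⟨ disjointPaths-separate (arc u) (v ∸ u) (arc w) (x ∸ w)
                                (arc-path u (v ∸ u)) (arc-path w (x ∸ w)) disjoint ⟩
    false ∎
    where
    open ≡-Reasoning
    start : ∀ y → arc y 0 ≡ y mod n
    start y = cong (_mod n) (+-identityʳ y)
    end : ∀ {y z} → y ≤ z → arc y (z ∸ y) ≡ z mod n
    end y≤z = cong (_mod n) (m+[n∸m]≡n y≤z)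
    within : ∀ {y z} i → y ≤ z → i ≤ z ∸ y → y + i ≤ z
    within {y} i y≤z i≤ = subst (y + i ≤_) (m+[n∸m]≡n y≤z) (+-monoʳ-≤ y i≤)
    disjoint : ∀ i j → i ≤ v ∸ u → j ≤ x ∸ w → arc u i ≢ arc w j
    disjoint i j i≤ j≤ = mod-distinct (≤-<-trans (within i u≤v i≤) v<n)
                           (≤-<-trans (within i u≤v i≤) (<-≤-trans v<w (m≤m+n w j)))
                           (≤-<-trans (within j w≤x j≤) (<-≤-trans x<n+u (+-monoʳ-≤ n (m≤m+n u i))))

  noCrossingChords : ∀ {a b c d} → a < b → b < c → c < d → d < n →
                     Edge G (a mod n) (c mod n) → Edge G (b mod n) (d mod n) → ⊥
  noCrossingChords {a} {b} {c} {d} a<b b<c c<d d<n eac ebd =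
    contradiction (trans (sym (cong₂ _xor_ acSeparatesBd (cong₂ _xor_ abSeparatesCd bcSeparatesDa)))
                         (threePairings (distinct a<b b<n) (distinct (<-trans a<b b<c) c<n) (distinct b<c c<n)))
                  λ ()
    where
    c<n : c < n
    c<n = <-trans c<d d<n
    b<n : b < n
    b<n = <-trans b<c c<n
    distinct : ∀ {x y} → x < y → y < n → x mod n ≢ y mod n
    distinct {x} {y} x<y y<n = mod-distinct (<-trans x<y y<n) x<y (<-≤-trans y<n (m≤m+n n x))
    acSeparatesBd : separates (a mod n) (c mod n) (b mod n) (d mod n) ≡ false
    acSeparatesBd = trans (cong (_xor inside (a mod n) (c mod n) (d mod n))
                                (edge-sameSide eac ebd (distinct a<b b<n ∘ sym) (distinct b<c c<n)
                                                       (distinct (<-trans a<b (<-trans b<c c<d)) d<n ∘ sym)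
                                                       (distinct c<d d<n ∘ sym)))
                          (xor-same (inside (a mod n) (c mod n) (d mod n)))
    abSeparatesCd : separates (a mod n) (b mod n) (c mod n) (d mod n) ≡ false
    abSeparatesCd = arcs-separate (<⇒≤ a<b) b<c (<⇒≤ c<d) (<-≤-trans d<n (m≤m+n n a)) b<n
    bcSeparatesDa : separates (b mod n) (c mod n) (d mod n) (a mod n) ≡ false
    bcSeparatesDa = trans (cong (separates (b mod n) (c mod n) (d mod n)) (mod-cong (sym wrap)))
                          (arcs-separate (<⇒≤ b<c) c<d d≤n+a (+-monoʳ-< n a<b) c<n)
      where
      d≤n+a : d ≤ n + a
      d≤n+a = ≤-trans (<⇒≤ d<n) (m≤m+n n a)
      wrap : (n + a) % n ≡ a % n
      wrap = trans (cong (_% n) (+-comm n a)) ([m+n]%n≡m%n a n)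

-- Sweep triangulations of a polygon

addEdge-new : ∀ {m} (G : Graph m) u v (u≢v : u ≢ v) → Edge (addEdge G u v u≢v) u v
addEdge-new G u v u≢v with u ≟ᶠ u | v ≟ᶠ v
... | yes _   | yes _   = ∨-zeroʳ (adj G u v)
... | no u≢u  | _       = contradiction refl u≢u
... | yes _   | no v≢v  = contradiction refl v≢v

addEdge-old : ∀ {m} (G : Graph m) u v (u≢v : u ≢ v) {a b} → Edge G a b → Edge (addEdge G u v u≢v) a b
addEdge-old G u v u≢v e rewrite e = refl

-- The polygon 0, 1, …, n' triangulated by a sequence of steps: after s
-- steps the current diagonal is (I s , top s); a bottom step advances the
-- bottom endpoint by one, a top step moves the top endpoint down by one.
module Polygon (bottom : ℕ → Bool) (n'' : ℕ) where

  n' n : ℕ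
  n' = suc n''
  n  = suc n'

  I J : ℕ → ℕ
  I = count bottom
  J = count (not ∘ bottom)

  I+J≡ : ∀ s → I s + J s ≡ s
  I+J≡ = count+count-not bottom

  top : ℕ → ℕ
  top s = n' ∸ J s

  P Q : ℕ
  P = I n''
  Q = J n''

  -- x ≤ P < y is the diagonal (I s , top s) for s = x + (n' ∸ y).
  Chord : ℕ → ℕ → Set
  Chord x y = x ≤ P × P < y × I (x + (n' ∸ y)) ≡ x

  chord? : ∀ x y → Dec (Chord x y)
  chord? x y = (x ≤? P) ×-dec (P <? y) ×-dec (I (x + (n' ∸ y)) ≟ x)

  Adj : ℕ → ℕ → Set
  Adj x y = suc x ≡ y ⊎ suc y ≡ x ⊎ Chord x y ⊎ Chord y x

  adj? : ∀ x y → Dec (Adj x y)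
  adj? x y = (suc x ≟ y) ⊎-dec (suc y ≟ x) ⊎-dec chord? x y ⊎-dec chord? y x

  Adj-sym : ∀ {x y} → Adj x y → Adj y x
  Adj-sym (inj₁ e)               = inj₂ (inj₁ e)
  Adj-sym (inj₂ (inj₁ e))        = inj₁ e
  Adj-sym (inj₂ (inj₂ (inj₁ c))) = inj₂ (inj₂ (inj₂ c))
  Adj-sym (inj₂ (inj₂ (inj₂ c))) = inj₂ (inj₂ (inj₁ c))

  Adj-irrefl : ∀ x → ¬ Adj x x
  Adj-irrefl x (inj₁ e)                             = 1+n≢n e
  Adj-irrefl x (inj₂ (inj₁ e))                      = 1+n≢n e
  Adj-irrefl x (inj₂ (inj₂ (inj₁ (x≤P , P<x , _)))) = <⇒≱ P<x x≤P
  Adj-irrefl x (inj₂ (inj₂ (inj₂ (x≤P , P<x , _)))) = <⇒≱ P<x x≤P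

  H : Graph n
  H = record
    { adj    = λ u v → does (adj? (toℕ u) (toℕ v))
    ; sym    = λ u v → symmetric (adj? (toℕ u) (toℕ v)) (adj? (toℕ v) (toℕ u))
    ; irrefl = λ v → dec-false (adj? (toℕ v) (toℕ v)) (Adj-irrefl (toℕ v))
    }
    where
    symmetric : ∀ {x y} (d : Dec (Adj x y)) (d' : Dec (Adj y x)) → does d ≡ does d'
    symmetric (yes a) d' = sym (dec-true d' (Adj-sym a))
    symmetric (no ¬a) d' = sym (dec-false d' (¬a ∘ Adj-sym))

  lab : ℕ → Fin n
  lab x = x mod n

  toℕ-lab : ∀ {x} → x < n → toℕ (lab x) ≡ x
  toℕ-lab {x} x<n = trans (toℕ-mod x n) (m<n⇒m%n≡m x<n)

  lab-toℕ : ∀ u → lab (toℕ u) ≡ u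
  lab-toℕ u = toℕ-injective (toℕ-lab (toℕ<n u))

  lab-injective : ∀ {x y} → x < n → y < n → lab x ≡ lab y → x ≡ y
  lab-injective x<n y<n e = trans (sym (toℕ-lab x<n)) (trans (cong toℕ e) (toℕ-lab y<n))

  Edge⇒Adj : ∀ {u v} → Edge H u v → Adj (toℕ u) (toℕ v)
  Edge⇒Adj {u} {v} = does⇒ (adj? (toℕ u) (toℕ v))
    where
    does⇒ : ∀ {A : Set} (d : Dec A) → does d ≡ true → A
    does⇒ (yes a) _ = a

  Adj⇒Edge : ∀ {x y} → x < n → y < n → Adj x y → Edge H (lab x) (lab y)
  Adj⇒Edge {x} {y} x<n y<n a =
    dec-true (adj? (toℕ (lab x)) (toℕ (lab y))) (subst₂ Adj (sym (toℕ-lab x<n)) (sym (toℕ-lab y<n)) a)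

  step-bottom : ∀ {s} → bottom s ≡ true → I (suc s) ≡ suc (I s) × J (suc s) ≡ J s
  step-bottom {s} e = trans (count-snoc bottom s) (trans (cong (λ b → I s + ind b) e) (+-comm (I s) 1)) ,
                      trans (count-snoc (not ∘ bottom) s) (trans (cong (λ b → J s + ind (not b)) e) (+-identityʳ (J s)))

  step-top : ∀ {s} → bottom s ≡ false → I (suc s) ≡ I s × J (suc s) ≡ suc (J s)
  step-top {s} e = trans (count-snoc bottom s) (trans (cong (λ b → I s + ind b) e) (+-identityʳ (I s))) ,
                   trans (count-snoc (not ∘ bottom) s) (trans (cong (λ b → J s + ind (not b)) e) (+-comm (J s) 1))

  P+Q≡ : P + Q ≡ n''
  P+Q≡ = I+J≡ n''

  I≤ : ∀ s → I s ≤ s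
  I≤ = count≤length bottom

  J≤ : ∀ s → J s ≤ s
  J≤ = count≤length (not ∘ bottom)

  P<n' : P < n'
  P<n' = s≤s (I≤ n'')

  top<n : ∀ s → top s < n
  top<n s = s≤s (m∸n≤m n' (J s))

  P<n'∸ : ∀ {j} → j ≤ Q → P < n' ∸ j
  P<n'∸ {j} j≤Q = m+n≤o⇒m≤o∸n (suc P) (s≤s (subst (P + j ≤_) P+Q≡ (+-monoʳ-≤ P j≤Q)))

  above-P : ∀ {z} → P < z → z ≤ n' → n' ∸ z ≤ Q
  above-P {z} P<z z≤n' = +-cancelˡ-≤ P _ _ (subst (P + (n' ∸ z) ≤_) (sym P+Q≡)
    (s≤s⁻¹ (subst (suc P + (n' ∸ z) ≤_) (m+[n∸m]≡n z≤n') (+-monoˡ-≤ (n' ∸ z) P<z))))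

  J≤n' : ∀ {s} → s ≤ n'' → J s ≤ n'
  J≤n' {s} s≤ = ≤-trans (J≤ s) (m≤n⇒m≤1+n s≤)

  n'∸top : ∀ {s} → s ≤ n'' → n' ∸ top s ≡ J s
  n'∸top s≤ = m∸[m∸n]≡n (J≤n' s≤)

  diagonal : ∀ {s} → s ≤ n'' → Chord (I s) (top s)
  diagonal {s} s≤ = count-mono bottom s≤ , P<n'∸ (count-mono (not ∘ bottom) s≤) ,
                    cong I (trans (cong (I s +_) (m∸[m∸n]≡n (J≤n' s≤))) (I+J≡ s))

  reached-bottom : ∀ {z} → z ≤ P → ∃ λ s → s ≤ n'' × I s ≡ z
  reached-bottom z≤P = count-intermediate bottom n'' _ z≤P

  reached-top : ∀ {z} → P < z → z ≤ n' → ∃ λ s → s ≤ n'' × top s ≡ z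
  reached-top {z} P<z z≤n'
    with s , s≤ , Js≡ ← count-intermediate (not ∘ bottom) n'' (n' ∸ z) (above-P P<z z≤n') =
    s , s≤ , trans (cong (n' ∸_) Js≡) (m∸[m∸n]≡n z≤n')

  jump⇒Chord : ∀ {x z y} → x < z → z < y → Adj x y → Chord x y
  jump⇒Chord x<z z<y (inj₁ refl)                     = contradiction (s≤s⁻¹ z<y) (<⇒≱ x<z)
  jump⇒Chord x<z z<y (inj₂ (inj₁ refl))              = contradiction (<-trans x<z z<y) (<⇒≱ (n<1+n _) ∘ <⇒≤)
  jump⇒Chord x<z z<y (inj₂ (inj₂ (inj₁ c)))          = c
  jump⇒Chord x<z z<y (inj₂ (inj₂ (inj₂ (y≤P , P<x , _)))) =
    contradiction (<-trans P<x (<-trans x<z z<y)) (≤⇒≯ y≤P)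

  outerplanar : Outerplanar H
  outerplanar = id , id , λ a b c d eab ecd (a<c , c<b , b<d) →
    let (_ , _ , e)  = jump⇒Chord a<c c<b (Edge⇒Adj eab)
        (_ , _ , e') = jump⇒Chord c<b b<d (Edge⇒Adj ecd)
    in count-chain bottom e e' a<c (∸-monoʳ-< b<d (s≤s⁻¹ (toℕ<n d)))

  consecutive : ∀ {r} → r < n → Adj r (suc r % n)
  consecutive {r} r<n with suc r <? n
  ... | yes 1+r<n = inj₁ (sym (m<n⇒m%n≡m 1+r<n))
  ... | no  1+r≮n = subst (λ z → Adj z (suc z % n)) (≤-antisym (s≤s⁻¹ (≮⇒≥ 1+r≮n)) (s≤s⁻¹ r<n))
                      (subst (Adj n') (sym (n%n≡0 n)) (inj₂ (inj₂ (inj₂ wrap))))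
    where
    wrap : Chord 0 n'
    wrap = z≤n , P<n' , cong I (cong (0 +_) (n∸n≡0 n'))

  cycle : ∀ x → Edge H (lab x) (lab (suc x))
  cycle x = dec-true (adj? _ _) (subst₂ Adj (sym (toℕ-mod x n)) (sym (trans (toℕ-mod (suc x) n) suc%))
                                           (consecutive (m%n<n x n)))
    where
    suc% : suc x % n ≡ suc (x % n) % n
    suc% = trans (cong (λ z → suc z % n) (m≡m%n+[m/n]*n x n)) ([m+kn]%n≡m%n (suc (x % n)) (x / n) n)

  module Supergraph (G : Graph n) (op : Outerplanar G) (H⊆G : ∀ {u v} → Edge H u v → Edge G u v) where
    open HamiltonianCycle G op (H⊆G ∘ cycle)

    chordEdge : ∀ {x y} → y < n → Chord x y → Edge G (lab x) (lab y)
    chordEdge y<n c@(x≤P , _ , _) =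
      H⊆G (Adj⇒Edge (≤-<-trans x≤P (<-trans P<n' (n<1+n n'))) y<n (inj₂ (inj₂ (inj₁ c))))

    bottomPair-noEdge : ∀ {x y} → suc x < y → y ≤ P → ¬ Edge G (lab x) (lab y)
    bottomPair-noEdge {x} {y} 1+x<y y≤P exy with s , s≤ , Is≡ ← reached-bottom (≤-trans (<⇒≤ 1+x<y) y≤P) =
      noCrossingChords (n<1+n x) 1+x<y (≤-<-trans y≤P (proj₁ (proj₂ (diagonal s≤)))) (top<n s) exy
                       (chordEdge (top<n s) (subst (λ z → Chord z (top s)) Is≡ (diagonal s≤)))

    topPair-noEdge : ∀ {x y} → P < x → suc x < y → y < n → ¬ Edge G (lab x) (lab y)
    topPair-noEdge {x} {y} P<x 1+x<y y<n exy
      with s , s≤ , top≡ ← reached-top (<-trans P<x (n<1+n x)) (<⇒≤ (<-≤-trans 1+x<y (s≤s⁻¹ y<n))) =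
      noCrossingChords (≤-<-trans (proj₁ (diagonal s≤)) P<x) (n<1+n x) 1+x<y y<n
                       (chordEdge (<-trans 1+x<y y<n) (subst (Chord (I s)) top≡ (diagonal s≤))) exy

    straddlingPair-noEdge : ∀ {x y} → x ≤ P → P < y → y < n → ¬ Chord x y → ¬ Edge G (lab x) (lab y)
    straddlingPair-noEdge {x} {y} x≤P P<y y<n ¬chord = crossedBy (diagonal s≤) (<-cmp (I s) x)
      where
      s : ℕ
      s = x + (n' ∸ y)
      y≤n' : y ≤ n'
      y≤n' = s≤s⁻¹ y<n
      s≤ : s ≤ n''
      s≤ = subst (s ≤_) P+Q≡ (+-mono-≤ x≤P (above-P P<y y≤n'))
      crossedBy : Chord (I s) (top s) → Tri (I s < x) (I s ≡ x) (x < I s) → ¬ Edge G (lab x) (lab y)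
      crossedBy _                 (tri≈ _ Is≡x _) _   = ¬chord (x≤P , P<y , Is≡x)
      crossedBy d@(_ , P<top , _) (tri< Is<x _ _) exy =
        noCrossingChords Is<x (≤-<-trans x≤P P<top) top<y y<n (chordEdge (top<n s) d) exy
        where
        top<y : top s < y
        top<y = subst (top s <_) (m∸[m∸n]≡n y≤n')
                  (∸-monoʳ-< (+-cancelˡ-< x _ _ (subst (_< x + J s) (I+J≡ s) (+-monoˡ-< (J s) Is<x))) (J≤n' s≤))
      crossedBy d@(Is≤P , _ , _)  (tri> _ _ x<Is) exy =
        noCrossingChords x<Is (≤-<-trans Is≤P P<y) y<top (top<n s) exy (chordEdge (top<n s) d)
        where
        y<top : y < top s
        y<top = subst (_< top s) (m∸[m∸n]≡n y≤n')
                  (∸-monoʳ-< (+-cancelˡ-< (I s) _ _ (subst (_< I s + (n' ∸ y)) (sym (I+J≡ s))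
                                                              (+-monoˡ-< (n' ∸ y) x<Is)))
                             (m∸n≤m n' y))

    nonAdjacent-noEdge : ∀ {x y} → x < y → y < n → ¬ Adj x y → ¬ Edge G (lab x) (lab y)
    nonAdjacent-noEdge {x} {y} x<y y<n ¬xy = bySide (y ≤? P) (P <? x)
      where
      1+x<y : suc x < y
      1+x<y = ≤∧≢⇒< x<y (¬xy ∘ inj₁)
      bySide : Dec (y ≤ P) → Dec (P < x) → ¬ Edge G (lab x) (lab y)
      bySide (yes y≤P) _         = bottomPair-noEdge 1+x<y y≤P
      bySide (no _)    (yes P<x) = topPair-noEdge P<x 1+x<y y<n
      bySide (no y≰P)  (no x≮P)  =
        straddlingPair-noEdge (≮⇒≥ x≮P) (≰⇒> y≰P) y<n (¬xy ∘ inj₂ ∘ inj₂ ∘ inj₁)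

  maximal : ∀ u v (u≢v : u ≢ v) → adj H u v ≡ false → ¬ Outerplanar (addEdge H u v u≢v)
  maximal u v u≢v nonEdge op = byOrder (<-cmp (toℕ u) (toℕ v))
    where
    G : Graph n
    G = addEdge H u v u≢v
    open Supergraph G op (λ {a} {b} → addEdge-old H u v u≢v {a} {b})
    ¬Adj : ¬ Adj (toℕ u) (toℕ v)
    ¬Adj a = contradiction (trans (sym nonEdge) (dec-true (adj? _ _) a)) λ ()
    new : Edge G (lab (toℕ u)) (lab (toℕ v))
    new = subst₂ (Edge G) (sym (lab-toℕ u)) (sym (lab-toℕ v)) (addEdge-new H u v u≢v)
    byOrder : Tri (toℕ u < toℕ v) (toℕ u ≡ toℕ v) (toℕ v < toℕ u) → ⊥
    byOrder (tri< u<v _ _) = nonAdjacent-noEdge u<v (toℕ<n v) ¬Adj new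
    byOrder (tri≈ _ e _)   = u≢v (toℕ-injective e)
    byOrder (tri> _ _ v<u) = nonAdjacent-noEdge v<u (toℕ<n u) (¬Adj ∘ Adj-sym) (Edge-sym G {lab (toℕ u)} new)

  apex : ℕ → ℕ
  apex s = if bottom s then I (suc s) else top (suc s)

  triangle : ℕ → Triple n
  triangle s = lab (I s) , lab (apex s) , lab (top s)

  I<n : ∀ {s} → s ≤ n'' → I s < n
  I<n {s} s≤ = s≤s (≤-trans (I≤ s) (m≤n⇒m≤1+n s≤))

  lab-< : ∀ {x y} → x < y → y < n → lab x Fin.< lab y
  lab-< {x} {y} x<y y<n = subst₂ _<_ (sym (toℕ-lab (<-trans x<y y<n))) (sym (toℕ-lab y<n)) x<y

  apex-bottom : ∀ {s} → bottom s ≡ true → apex s ≡ I (suc s)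
  apex-bottom {s} e rewrite e = refl

  apex-top : ∀ {s} → bottom s ≡ false → apex s ≡ top (suc s)
  apex-top {s} e rewrite e = refl

  triangle-sorted : ∀ {x y z} → x < y → y < z → z < n → Adj x y → Adj y z → Adj x z →
                    IsTriangle H (lab x , lab y , lab z)
  triangle-sorted {x} {y} {z} x<y y<z z<n xy yz xz =
    lab-< x<y y<n , lab-< y<z z<n , Adj⇒Edge x<n y<n xy , Adj⇒Edge y<n z<n yz , Adj⇒Edge x<n z<n xz
    where
    y<n : y < n
    y<n = <-trans y<z z<n
    x<n : x < n
    x<n = <-trans x<y y<n

  isTriangle : ∀ {s} → s < n'' → IsTriangle H (triangle s)
  isTriangle {s} s<n'' = byStep (bottom s) refl
    where
    byStep : ∀ b → bottom s ≡ b → IsTriangle H (triangle s)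
    byStep true e = subst (λ a → IsTriangle H (lab (I s) , lab a , lab (top s))) (sym (trans (apex-bottom e) eI))
                      (triangle-sorted (n<1+n (I s)) (≤-<-trans (proj₁ next) (proj₁ (proj₂ next))) (top<n s)
                                       (inj₁ refl) (inj₂ (inj₂ (inj₁ next))) (inj₂ (inj₂ (inj₁ (diagonal (<⇒≤ s<n''))))))
      where
      eI : I (suc s) ≡ suc (I s)
      eI = proj₁ (step-bottom e)
      next : Chord (suc (I s)) (top s)
      next = subst₂ Chord eI (cong (n' ∸_) (proj₂ (step-bottom e))) (diagonal s<n'')
    byStep false e = subst (λ a → IsTriangle H (lab (I s) , lab a , lab (top s))) (sym (apex-top e))
                       (triangle-sorted (≤-<-trans (proj₁ next) (proj₁ (proj₂ next))) (subst (top (suc s) <_) up (n<1+n _)) (top<n s)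
                                        (inj₂ (inj₂ (inj₁ next))) (inj₁ up) (inj₂ (inj₂ (inj₁ (diagonal (<⇒≤ s<n''))))))
      where
      eJ : J (suc s) ≡ suc (J s)
      eJ = proj₂ (step-top e)
      next : Chord (I s) (top (suc s))
      next = subst (λ i → Chord i (top (suc s))) (proj₁ (step-top e)) (diagonal s<n'')
      up : suc (top (suc s)) ≡ top s
      up = trans (cong (λ j → suc (n' ∸ j)) eJ) (sym (+-∸-assoc 1 (subst (_≤ n') eJ (J≤n' s<n''))))

  triangle-injective : ∀ {s s'} → s < n'' → s' < n'' → triangle s ≡ triangle s' → s ≡ s'
  triangle-injective {s} {s'} s< s'< e = begin
    s            ≡⟨ I+J≡ s ⟨
    I s + J s    ≡⟨ cong₂ _+_ sameI sameJ ⟩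
    I s' + J s'  ≡⟨ I+J≡ s' ⟩
    s'           ∎
    where
    open ≡-Reasoning
    sameI : I s ≡ I s'
    sameI = lab-injective (I<n (<⇒≤ s<)) (I<n (<⇒≤ s'<)) (cong proj₁ e)
    sameTop : top s ≡ top s'
    sameTop = lab-injective (top<n s) (top<n s') (cong (proj₂ ∘ proj₂) e)
    sameJ : J s ≡ J s'
    sameJ = trans (sym (n'∸top (<⇒≤ s<))) (trans (cong (n' ∸_) sameTop) (n'∸top (<⇒≤ s'<)))

  bottomAdj : ∀ {x y} → x < y → y ≤ P → Adj x y → suc x ≡ y
  bottomAdj x<y y≤P (inj₁ e)                           = e
  bottomAdj x<y y≤P (inj₂ (inj₁ refl))                 = contradiction x<y (<⇒≱ (n<1+n _) ∘ <⇒≤)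
  bottomAdj x<y y≤P (inj₂ (inj₂ (inj₁ (_ , P<y , _)))) = contradiction y≤P (<⇒≱ P<y)
  bottomAdj x<y y≤P (inj₂ (inj₂ (inj₂ (_ , P<x , _)))) = contradiction (≤-trans (<⇒≤ x<y) y≤P) (<⇒≱ P<x)

  topAdj : ∀ {x y} → P < x → x < y → Adj x y → suc x ≡ y
  topAdj P<x x<y (inj₁ e)                           = e
  topAdj P<x x<y (inj₂ (inj₁ refl))                 = contradiction x<y (<⇒≱ (n<1+n _) ∘ <⇒≤)
  topAdj P<x x<y (inj₂ (inj₂ (inj₁ (x≤P , _ , _)))) = contradiction x≤P (<⇒≱ P<x)
  topAdj P<x x<y (inj₂ (inj₂ (inj₂ (y≤P , _ , _)))) = contradiction y≤P (<⇒≱ (<-trans P<x x<y))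

  straddleAdj : ∀ {x y} → x ≤ P → P < y → Adj x y → Chord x y
  straddleAdj x≤P P<y (inj₁ refl) with refl ← ≤-antisym x≤P (s≤s⁻¹ P<y) =
    x≤P , P<y , cong I (m+[n∸m]≡n (I≤ n''))
  straddleAdj x≤P P<y (inj₂ (inj₁ refl))                 = contradiction (≤-trans (n≤1+n _) x≤P) (<⇒≱ P<y)
  straddleAdj x≤P P<y (inj₂ (inj₂ (inj₁ c)))             = c
  straddleAdj x≤P P<y (inj₂ (inj₂ (inj₂ (_ , P<x , _)))) = contradiction x≤P (<⇒≱ P<x)

  J-chord : ∀ {x z} → Chord x z → J (x + (n' ∸ z)) ≡ n' ∸ z
  J-chord {x} {z} (_ , _ , e) = +-cancelˡ-≡ x _ _ (trans (cong (_+ J (x + (n' ∸ z))) (sym e)) (I+J≡ (x + (n' ∸ z))))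

  -- A triangle of H with longest side xz is the triangle of the step at which xz is the diagonal.
  apex-of-chord : ∀ {x y z} → Chord x z → z ≤ n' → x < y → y < z → Adj x y → Adj y z →
                  apex (x + (n' ∸ z)) ≡ y
  apex-of-chord {x} {y} {z} xz@(x≤P , P<z , Is≡x) z≤n' x<y y<z xy yz = byStep (bottom s) refl (y ≤? P)
    where
    s : ℕ
    s = x + (n' ∸ z)
    gap : P < y → n' ∸ y ≡ suc (n' ∸ z)
    gap P<y = trans (+-∸-assoc 1 (subst (_≤ n') (sym 1+y≡z) z≤n')) (cong (λ w → suc (n' ∸ w)) 1+y≡z)
      where 1+y≡z = topAdj P<y y<z yz
    byStep : ∀ b → bottom s ≡ b → Dec (y ≤ P) → apex s ≡ y
    byStep true e (yes y≤P) =
      trans (apex-bottom e) (trans (proj₁ (step-bottom e)) (trans (cong suc Is≡x) (bottomAdj x<y y≤P xy)))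
    byStep false e (yes y≤P) = contradiction (trans (sym y≡) (trans (proj₁ (step-top e)) Is≡x)) (<⇒≢ x<y ∘ sym)
      where
      y≡ : I (suc s) ≡ y
      y≡ = trans (cong (λ w → I (w + (n' ∸ z))) (bottomAdj x<y y≤P xy))
                 (proj₂ (proj₂ (straddleAdj y≤P P<z yz)))
    byStep true e (no y≰P) =
      contradiction (trans (sym x≡) (trans (proj₁ (step-bottom e)) (cong suc Is≡x))) (1+n≢n ∘ sym)
      where
      x≡ : I (suc s) ≡ x
      x≡ = trans (cong I (trans (sym (+-suc x (n' ∸ z))) (cong (x +_) (sym (gap (≰⇒> y≰P))))))
                 (proj₂ (proj₂ (straddleAdj x≤P (≰⇒> y≰P) xy)))
    byStep false e (no y≰P) = begin
      apex s                     ≡⟨ apex-top e ⟩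
      n' ∸ J (suc s)             ≡⟨ cong (n' ∸_) (trans (proj₂ (step-top e)) (cong suc (J-chord xz))) ⟩
      n' ∸ suc (n' ∸ z)          ≡⟨ cong (n' ∸_) (gap (≰⇒> y≰P)) ⟨
      n' ∸ (n' ∸ y)              ≡⟨ m∸[m∸n]≡n (≤-trans (<⇒≤ y<z) z≤n') ⟩
      y                          ∎
      where open ≡-Reasoning

  triangles : Fin n'' → Triple n
  triangles i = triangle (toℕ i)

  triangle-complete : ∀ t → IsTriangle H t → ∃ λ i → triangles i ≡ t
  triangle-complete (a , b , c) (a<b , b<c , eab , ebc , eac) =
    fromℕ< s<n'' , trans (cong triangle (toℕ-fromℕ< s<n'')) same
    where
    x z : ℕ
    x = toℕ a
    z = toℕ c
    xz : Chord x z
    xz = jump⇒Chord a<b b<c (Edge⇒Adj eac)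
    z≤n' : z ≤ n'
    z≤n' = s≤s⁻¹ (toℕ<n c)
    s : ℕ
    s = x + (n' ∸ z)
    s<n'' : s < n''
    s<n'' = s≤s⁻¹ (subst (suc (suc s) ≤_) (m+[n∸m]≡n z≤n') (+-monoˡ-≤ (n' ∸ z) (<-≤-trans (s≤s a<b) b<c)))
    same : triangle s ≡ (a , b , c)
    same = cong₂ _,_ (trans (cong lab (proj₂ (proj₂ xz))) (lab-toℕ a))
             (cong₂ _,_ (trans (cong lab (apex-of-chord xz z≤n' a<b b<c (Edge⇒Adj eab) (Edge⇒Adj ebc))) (lab-toℕ b))
                        (trans (cong lab (trans (cong (n' ∸_) (J-chord xz)) (m∸[m∸n]≡n z≤n'))) (lab-toℕ c)))

  Between : ℕ → ℕ → Set
  Between s x = (x ≤ P × I s ≤ x × x ≤ I (suc s)) ⊎ (P < x × J s ≤ n' ∸ x × n' ∸ x ≤ J (suc s))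

  I-step≤ : ∀ s → I s ≤ I (suc s)
  I-step≤ s = count-mono bottom (n≤1+n s)

  J-step≤ : ∀ s → J s ≤ J (suc s)
  J-step≤ s = count-mono (not ∘ bottom) (n≤1+n s)

  vertex-between : ∀ {s u} → s < n'' → u ∈t triangle s → Between s (toℕ u)
  vertex-between {s} s< (inj₁ refl) rewrite toℕ-lab (I<n (<⇒≤ s<)) =
    inj₁ (proj₁ (diagonal (<⇒≤ s<)) , ≤-refl , I-step≤ s)
  vertex-between {s} s< (inj₂ (inj₂ refl)) rewrite toℕ-lab (top<n s) | n'∸top (<⇒≤ s<) =
    inj₂ (proj₁ (proj₂ (diagonal (<⇒≤ s<))) , ≤-refl , J-step≤ s)
  vertex-between {s} s< (inj₂ (inj₁ refl)) = byStep (bottom s) refl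
    where
    byStep : ∀ b → bottom s ≡ b → Between s (toℕ (lab (apex s)))
    byStep true e rewrite apex-bottom e | toℕ-lab (I<n s<) =
      inj₁ (proj₁ (diagonal s<) , I-step≤ s , ≤-refl)
    byStep false e rewrite apex-top e | toℕ-lab (top<n (suc s)) | n'∸top s< =
      inj₂ (proj₁ (proj₂ (diagonal s<)) , J-step≤ s , ≤-refl)

  -- x is an endpoint of the diagonal after step s, and that endpoint does not move until step s'.
  Pinned : ℕ → ℕ → ℕ → Set
  Pinned s s' x = (x ≡ I (suc s) × I (suc s) ≡ I s') ⊎ (P < x × n' ∸ x ≡ J (suc s) × J (suc s) ≡ J s')

  shared-pinned : ∀ {s s' x} → suc s ≤ s' → Between s x → Between s' x → Pinned s s' x
  shared-pinned s< (inj₁ (_ , _ , x≤)) (inj₁ (_ , ≤x , _)) =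
    inj₁ (≤-antisym x≤ (≤-trans (count-mono bottom s<) ≤x) ,
          ≤-antisym (count-mono bottom s<) (≤-trans ≤x x≤))
  shared-pinned s< (inj₂ (P<x , _ , x≤)) (inj₂ (_ , ≤x , _)) =
    inj₂ (P<x , ≤-antisym x≤ (≤-trans (count-mono (not ∘ bottom) s<) ≤x) ,
                ≤-antisym (count-mono (not ∘ bottom) s<) (≤-trans ≤x x≤))
  shared-pinned s< (inj₁ (x≤P , _)) (inj₂ (P<x , _)) = contradiction x≤P (<⇒≱ P<x)
  shared-pinned s< (inj₂ (P<x , _)) (inj₁ (x≤P , _)) = contradiction x≤P (<⇒≱ P<x)

  shareEdge⇒consecutive : ∀ {s s'} → s < s' → s' < n'' → ShareEdge (triangle s) (triangle s') → suc s ≡ s'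
  shareEdge⇒consecutive {s} {s'} s<s' s'< (u , v , u≢v , u∈ , v∈ , u∈' , v∈') =
    pinned (shared-pinned s<s' (vertex-between s< u∈) (vertex-between s'< u∈'))
           (shared-pinned s<s' (vertex-between s< v∈) (vertex-between s'< v∈'))
    where
    s< : s < n''
    s< = <-trans s<s' s'<
    fromI+J : I (suc s) ≡ I s' → J (suc s) ≡ J s' → suc s ≡ s'
    fromI+J eI eJ = trans (sym (I+J≡ (suc s))) (trans (cong₂ _+_ eI eJ) (I+J≡ s'))
    topInjective : ∀ {x y : Fin n} → n' ∸ toℕ x ≡ n' ∸ toℕ y → x ≡ y
    topInjective {x} {y} e = toℕ-injective (trans (sym (m∸[m∸n]≡n (s≤s⁻¹ (toℕ<n x))))
                                           (trans (cong (n' ∸_) e) (m∸[m∸n]≡n (s≤s⁻¹ (toℕ<n y)))))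
    pinned : Pinned s s' (toℕ u) → Pinned s s' (toℕ v) → suc s ≡ s'
    pinned (inj₁ (eu , _))      (inj₁ (ev , _))      = contradiction (toℕ-injective (trans eu (sym ev))) u≢v
    pinned (inj₁ (_ , eI))      (inj₂ (_ , _ , eJ))  = fromI+J eI eJ
    pinned (inj₂ (_ , _ , eJ))  (inj₁ (_ , eI))      = fromI+J eI eJ
    pinned (inj₂ (_ , eu , _))  (inj₂ (_ , ev , _))  = contradiction (topInjective (trans eu (sym ev))) u≢v

  consecutive⇒shareEdge : ∀ {s} → suc s < n'' → ShareEdge (triangle s) (triangle (suc s))
  consecutive⇒shareEdge {s} 1+s< =
    lab (I (suc s)) , lab (top (suc s)) , distinct ,
    inOld (bottom s) refl , topInOld (bottom s) refl , inj₁ refl , inj₂ (inj₂ refl)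
    where
    diag : Chord (I (suc s)) (top (suc s))
    diag = diagonal (<⇒≤ 1+s<)
    distinct : lab (I (suc s)) ≢ lab (top (suc s))
    distinct e = <⇒≢ (≤-<-trans (proj₁ diag) (proj₁ (proj₂ diag)))
                     (lab-injective (I<n (<⇒≤ 1+s<)) (top<n (suc s)) e)
    inOld : ∀ b → bottom s ≡ b → lab (I (suc s)) ∈t triangle s
    inOld true  e = inj₂ (inj₁ (cong lab (sym (apex-bottom e))))
    inOld false e = inj₁ (cong lab (proj₁ (step-top e)))
    topInOld : ∀ b → bottom s ≡ b → lab (top (suc s)) ∈t triangle s
    topInOld true  e = inj₂ (inj₂ (cong (lab ∘ (n' ∸_)) (proj₂ (step-bottom e))))
    topInOld false e = inj₂ (inj₁ (cong lab (sym (apex-top e))))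

  ShareEdge-sym : ∀ {t t' : Triple n} → ShareEdge t t' → ShareEdge t' t
  ShareEdge-sym (u , v , u≢v , u∈ , v∈ , u∈' , v∈') = u , v , u≢v , u∈' , v∈' , u∈ , v∈

  weakDualIsPath : WeakDualIsPath H
  weakDualIsPath = n'' , triangles , injective , (λ i → isTriangle (toℕ<n i)) , triangle-complete , adjacency
    where
    injective : ∀ {i j} → triangles i ≡ triangles j → i ≡ j
    injective {i} {j} e = toℕ-injective (triangle-injective (toℕ<n i) (toℕ<n j) e)
    Consecutive : Fin n'' → Fin n'' → Set
    Consecutive i j = suc (toℕ i) ≡ toℕ j ⊎ suc (toℕ j) ≡ toℕ i
    adjacency : ∀ i j → i ≢ j → (ShareEdge (triangles i) (triangles j) → Consecutive i j) ×
                                 (Consecutive i j → ShareEdge (triangles i) (triangles j))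
    adjacency i j i≢j = share⇒ , ⇒share
      where
      share⇒ : ShareEdge (triangles i) (triangles j) → Consecutive i j
      share⇒ sh with <-cmp (toℕ i) (toℕ j)
      ... | tri< i<j _ _ = inj₁ (shareEdge⇒consecutive i<j (toℕ<n j) sh)
      ... | tri≈ _ e _   = contradiction (toℕ-injective e) i≢j
      ... | tri> _ _ j<i = inj₂ (shareEdge⇒consecutive j<i (toℕ<n i) (ShareEdge-sym sh))
      ⇒share : Consecutive i j → ShareEdge (triangles i) (triangles j)
      ⇒share (inj₁ e) = subst (λ s → ShareEdge (triangles i) (triangle s)) e
                                (consecutive⇒shareEdge (subst (_< n'') (sym e) (toℕ<n j)))
      ⇒share (inj₂ e) = ShareEdge-sym (subst (λ s → ShareEdge (triangles j) (triangle s)) e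
                                (consecutive⇒shareEdge (subst (_< n'') (sym e) (toℕ<n i))))

  maximalOuterpath : MaximalOuterpath H
  maximalOuterpath = (outerplanar , maximal) , weakDualIsPath

  -- At step s the diagonal turns around its pivot: the mover is replaced by the apex.
  pivot mover : ℕ → ℕ
  pivot s = if bottom s then top s else I s
  mover s = if bottom s then I s else top s

  pivot-keep : ∀ {s} → bottom (suc s) ≡ bottom s → pivot (suc s) ≡ pivot s × mover (suc s) ≡ apex s
  pivot-keep {s} same = byStep (bottom s) refl
    where
    byStep : ∀ b → bottom s ≡ b → pivot (suc s) ≡ pivot s × mover (suc s) ≡ apex s
    byStep true  e rewrite trans same e | e = cong (n' ∸_) (proj₂ (step-bottom e)) , refl
    byStep false e rewrite trans same e | e = proj₁ (step-top e) , refl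

  pivot-turn : ∀ {s} → bottom (suc s) ≡ not (bottom s) → pivot (suc s) ≡ apex s × mover (suc s) ≡ pivot s
  pivot-turn {s} turn = byStep (bottom s) refl
    where
    byStep : ∀ b → bottom s ≡ b → pivot (suc s) ≡ apex s × mover (suc s) ≡ pivot s
    byStep true  e rewrite trans turn (cong not e) | e = refl , cong (n' ∸_) (proj₂ (step-bottom e))
    byStep false e rewrite trans turn (cong not e) | e = refl , proj₁ (step-top e)

  ends-bottom : ∀ {s} → bottom s ≡ true → pivot s ≡ top s × mover s ≡ I s
  ends-bottom e rewrite e = refl , refl

  ends-top : ∀ {s} → bottom s ≡ false → pivot s ≡ I s × mover s ≡ top s
  ends-top e rewrite e = refl , refl

  triangle-edges : ∀ {s} → s < n'' → Edge H (lab (pivot s)) (lab (apex s)) × Edge H (lab (mover s)) (lab (apex s)) ×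
                                     Edge H (lab (pivot s)) (lab (mover s))
  triangle-edges {s} s< = byStep (bottom s) refl
    where
    e12 : Edge H (lab (I s)) (lab (apex s))
    e12 = proj₁ (proj₂ (proj₂ (isTriangle s<)))
    e23 : Edge H (lab (apex s)) (lab (top s))
    e23 = proj₁ (proj₂ (proj₂ (proj₂ (isTriangle s<))))
    e13 : Edge H (lab (I s)) (lab (top s))
    e13 = proj₂ (proj₂ (proj₂ (proj₂ (isTriangle s<))))
    byStep : ∀ b → bottom s ≡ b → Edge H (lab (pivot s)) (lab (apex s)) × Edge H (lab (mover s)) (lab (apex s)) ×
                                   Edge H (lab (pivot s)) (lab (mover s))
    byStep true  e with p≡ , m≡ ← ends-bottom e rewrite p≡ | m≡ =
      Edge-sym H {lab (apex s)} e23 , e12 , Edge-sym H {lab (I s)} e13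
    byStep false e with p≡ , m≡ ← ends-top e rewrite p≡ | m≡ = e12 , Edge-sym H {lab (apex s)} e23 , e13

  -- The vertices in the order in which the triangulation reaches them.
  vertex : ℕ → ℕ
  vertex 0               = mover 0
  vertex 1               = pivot 0
  vertex (suc (suc s))   = apex s

  apex-bottomSide : ∀ {s} → s < n'' → bottom s ≡ true → apex s ≡ suc (I s) × apex s ≤ P
  apex-bottomSide {s} s< e = trans (apex-bottom e) eI , subst (_≤ P) (sym (apex-bottom e)) (proj₁ (diagonal s<))
    where eI = proj₁ (step-bottom e)

  apex-topSide : ∀ {s} → s < n'' → bottom s ≡ false → apex s ≡ n' ∸ suc (J s) × P < apex s
  apex-topSide {s} s< e = trans (apex-top e) (cong (n' ∸_) (proj₂ (step-top e))) ,
                          subst (P <_) (sym (apex-top e)) (proj₁ (proj₂ (diagonal s<)))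

  apex-inner : ∀ {s} → s < n'' → 0 < apex s × apex s < n'
  apex-inner {s} s< = byStep (bottom s) refl
    where
    byStep : ∀ b → bottom s ≡ b → 0 < apex s × apex s < n'
    byStep true  e = subst (0 <_) (sym (proj₁ (apex-bottomSide s< e))) z<s ,
                     ≤-<-trans (proj₂ (apex-bottomSide s< e)) P<n'
    byStep false e = ≤-<-trans z≤n (proj₂ (apex-topSide s< e)) ,
                     subst (_< n') (sym (proj₁ (apex-topSide s< e)))
                           (∸-monoʳ-< z<s (subst (_≤ n') (proj₂ (step-top e)) (J≤n' s<)))

  apex-distinct : ∀ {s s'} → s < s' → s' < n'' → apex s ≢ apex s'
  apex-distinct {s} {s'} s<s' s'< = byStep (bottom s) refl (bottom s') refl
    where
    s< : s < n''
    s< = <-trans s<s' s'<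
    byStep : ∀ b → bottom s ≡ b → ∀ b' → bottom s' ≡ b' → apex s ≢ apex s'
    byStep true e true e' eq = <⇒≢ (s≤s (count-mono bottom s<s'))
      (trans (sym (apex-bottom e)) (trans eq (proj₁ (apex-bottomSide s'< e'))))
    byStep false e false e' eq = <⇒≢ (s≤s (count-mono (not ∘ bottom) s<s'))
      (∸-cancelˡ-≡ (J≤n' s<) (subst (_≤ n') (proj₂ (step-top e')) (J≤n' s'<))
                   (trans (sym (apex-top e)) (trans eq (proj₁ (apex-topSide s'< e')))))
    byStep true e false e' eq =
      <⇒≱ (proj₂ (apex-topSide s'< e')) (subst (_≤ P) eq (proj₂ (apex-bottomSide s< e)))
    byStep false e true e' eq =
      <⇒≱ (proj₂ (apex-topSide s< e)) (subst (_≤ P) (sym eq) (proj₂ (apex-bottomSide s'< e')))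

  first-vertices : (vertex 0 ≡ 0 × vertex 1 ≡ n') ⊎ (vertex 0 ≡ n' × vertex 1 ≡ 0)
  first-vertices with bottom 0
  ... | true  = inj₁ (refl , refl)
  ... | false = inj₂ (refl , refl)

  corner : ∀ {t} → t ≤ 1 → vertex t ≡ 0 ⊎ vertex t ≡ n'
  corner {0} _ with bottom 0
  ... | true  = inj₁ refl
  ... | false = inj₂ refl
  corner {1} _ with bottom 0
  ... | true  = inj₂ refl
  ... | false = inj₁ refl
  corner {suc (suc _)} (s≤s ())

  corner<n : ∀ {v} → v ≡ 0 ⊎ v ≡ n' → v < n
  corner<n (inj₁ refl) = z<s
  corner<n (inj₂ refl) = ≤-refl

  corner≢apex : ∀ {s v} → s < n'' → v ≡ 0 ⊎ v ≡ n' → v ≢ apex s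
  corner≢apex s< (inj₁ refl) eq = <⇒≢ (proj₁ (apex-inner s<)) eq
  corner≢apex s< (inj₂ refl) eq = <⇒≢ (proj₂ (apex-inner s<)) (sym eq)

  vertex-distinct : ∀ {t t'} → t < t' → t' < n → vertex t ≢ vertex t'
  vertex-distinct {0} {1} _ _ eq with first-vertices
  ... | inj₁ (e₀ , e₁) = 0≢1+n (trans (sym e₀) (trans eq e₁))
  ... | inj₂ (e₀ , e₁) = 0≢1+n (trans (sym e₁) (trans (sym eq) e₀))
  vertex-distinct {1} {1} (s≤s ())
  vertex-distinct {0} {suc (suc s')} _ t'<n = corner≢apex (s≤s⁻¹ (s≤s⁻¹ t'<n)) (corner z≤n)
  vertex-distinct {1} {suc (suc s')} _ t'<n = corner≢apex (s≤s⁻¹ (s≤s⁻¹ t'<n)) (corner ≤-refl)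
  vertex-distinct {suc (suc s)} {suc (suc s')} (s≤s (s≤s s<s')) t'<n = apex-distinct s<s' (s≤s⁻¹ (s≤s⁻¹ t'<n))

  vertex<n : ∀ {t} → t < n → vertex t < n
  vertex<n {0}           _   = corner<n (corner z≤n)
  vertex<n {1}           _   = corner<n (corner ≤-refl)
  vertex<n {suc (suc s)} t<n = <-trans (proj₂ (apex-inner (s≤s⁻¹ (s≤s⁻¹ t<n)))) (n<1+n n')

-- Induced degrees in the zigzag sweep

unique⊆⇒length≤ : ∀ {m} {p : Subset m} {xs} → Unique xs → All (_∈ p) xs → length xs ≤ ∣ p ∣
unique⊆⇒length≤ []               []          = z≤n
unique⊆⇒length≤ (x∉xs ∷ unique) (x∈p ∷ xs⊆p) =
  ≤-trans (s≤s (unique⊆⇒length≤ unique (All.zipWith (λ (y≢x , y∈p) → x∈p∧x≢y⇒x∈p-y y∈p y≢x)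
                                                      (All.map (_∘ sym) x∉xs , xs⊆p))))
          (x∈p⇒∣p-x∣<∣p∣ x∈p)

∈-nbhd : ∀ {m} (G : Graph m) (S : Subset m) {h x} → Edge G h x → x ∈ S → x ∈ nbhd G h ∩ S
∈-nbhd G S {h} {x} e x∈S = x∈p∩q⁺ (lookup⇒[]= x _ (trans (lookup∘tabulate (adj G h) x) e) , x∈S)

length-filter-applyUpTo : ∀ {A : Set} {P : A → Set} (P? : ∀ x → Dec (P x)) (f : ℕ → A) l →
                          length (filter P? (applyUpTo f l)) ≡ count (λ t → does (P? (f t))) l
length-filter-applyUpTo P? f zero    = refl
length-filter-applyUpTo P? f (suc l) with does (P? (f 0))
... | true  = cong suc (length-filter-applyUpTo P? (f ∘ suc) l)
... | false = length-filter-applyUpTo P? (f ∘ suc) l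

m<[1+m/n]*n : ∀ m n .{{_ : NonZero n}} → m < suc (m / n) * n
m<[1+m/n]*n m n = begin-strict
  m                  ≡⟨ m≡m%n+[m/n]*n m n ⟩
  m % n + m / n * n  <⟨ +-monoˡ-< (m / n * n) (m%n<n m n) ⟩
  n + m / n * n      ∎
  where open ≤-Reasoning

m≤[1+[m∸1]/n]*n : ∀ m n .{{_ : NonZero n}} → m ≤ suc ((m ∸ 1) / n) * n
m≤[1+[m∸1]/n]*n zero    n = z≤n
m≤[1+[m∸1]/n]*n (suc m) n = m<[1+m/n]*n m n

alternating : ℕ → Bool
alternating zero    = true
alternating (suc i) = not (alternating i)

module Zigzag (k n'' : ℕ) where

  K : ℕ
  K = 3 + k

  zigzag : ℕ → Bool
  zigzag s = alternating (s / K)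

  open Polygon zigzag n'' public

  zigzag-block : ∀ i {r} → r < K → zigzag (i * K + r) ≡ alternating i
  zigzag-block i {r} r<K = cong alternating (begin
    (i * K + r) / K      ≡⟨ +-distrib-/-∣ˡ r (n∣m*n i) ⟩
    i * K / K + r / K    ≡⟨ cong₂ _+_ (m*n/n≡m i K) (m<n⇒m/n≡0 r<K) ⟩
    i + 0                ≡⟨ +-identityʳ i ⟩
    i                    ∎)
    where open ≡-Reasoning

  last : ℕ → ℕ
  last i = i * K + (2 + k)

  suc-last : ∀ i → suc (last i) ≡ suc i * K
  suc-last i = trans (sym (+-suc (i * K) (2 + k))) (+-comm (i * K) K)

  within-block : ∀ i {r} → suc r < K → zigzag (suc (i * K + r)) ≡ zigzag (i * K + r)
  within-block i {r} 1+r<K = trans (cong zigzag (sym (+-suc (i * K) r)))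
                                   (trans (zigzag-block i 1+r<K) (sym (zigzag-block i (<-trans (n<1+n r) 1+r<K))))

  block-turn : ∀ i → zigzag (suc (last i)) ≡ not (zigzag (last i))
  block-turn i = trans (cong zigzag (trans (suc-last i) (sym (+-identityʳ (suc i * K)))))
                       (trans (zigzag-block (suc i) z<s) (cong not (sym (zigzag-block i ≤-refl))))

  hub : ℕ → ℕ
  hub i = pivot (i * K)

  pivot-block : ∀ i {r} → r < K → pivot (i * K + r) ≡ hub i
  pivot-block i {zero}  _      = cong pivot (+-identityʳ (i * K))
  pivot-block i {suc r} 1+r<K  = trans (cong pivot (+-suc (i * K) r))
    (trans (proj₁ (pivot-keep {i * K + r} (within-block i 1+r<K))) (pivot-block i (<-trans (n<1+n r) 1+r<K)))

  mover-next : ∀ i → mover (suc i * K) ≡ hub i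
  mover-next i = trans (cong mover (sym (suc-last i)))
                       (trans (proj₂ (pivot-turn {last i} (block-turn i))) (pivot-block i ≤-refl))

  hub-next : ∀ i → hub (suc i) ≡ apex (last i)
  hub-next i = trans (cong pivot (sym (suc-last i))) (proj₁ (pivot-turn {last i} (block-turn i)))

  hub-vertex : ∀ i → hub i ≡ vertex (suc (i * K))
  hub-vertex zero    = refl
  hub-vertex (suc i) = trans (hub-next i) (cong apex (suc-injective (suc-last i)))

  mover-last : ∀ i → mover (last i) ≡ apex (i * K + (1 + k))
  mover-last i = trans (cong mover (+-suc (i * K) (1 + k)))
                       (proj₂ (pivot-keep {i * K + (1 + k)} (within-block i ≤-refl)))

  -- The edges at hub i come from the triangles of block i and the first triangle of block i + 1.
  module Fan (i : ℕ) (fits : suc i * K < n'') where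

    block< : ∀ {j} → j ≤ K → i * K + j < n''
    block< {j} j≤K = ≤-<-trans (subst (i * K + j ≤_) (+-comm (i * K) K) (+-monoʳ-≤ (i * K) j≤K)) fits

    hub-apex : ∀ {j} → j < K → Edge H (lab (hub i)) (lab (apex (i * K + j)))
    hub-apex {j} j<K = subst (λ h → Edge H (lab h) (lab (apex (i * K + j)))) (pivot-block i j<K)
                                (proj₁ (triangle-edges {i * K + j} (block< (<⇒≤ j<K))))

    hub-nextApex : Edge H (lab (hub i)) (lab (apex (suc i * K)))
    hub-nextApex = subst (λ h → Edge H (lab h) (lab (apex (suc i * K)))) (mover-next i)
                         (proj₁ (proj₂ (triangle-edges {suc i * K} fits)))

    hub-mover : Edge H (lab (hub i)) (lab (mover (i * K)))
    hub-mover = subst (λ s → Edge H (lab (pivot s)) (lab (mover s))) (+-identityʳ (i * K))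
                      (proj₂ (proj₂ (triangle-edges {i * K + 0} (block< z≤n))))

  hub-previousApex : ∀ j → suc (suc j) * K < n'' → Edge H (lab (hub (suc j))) (lab (apex (j * K + (1 + k))))
  hub-previousApex j fits = Edge-sym H {lab (apex (j * K + (1 + k)))}
    (subst₂ (λ a h → Edge H (lab a) (lab h)) (mover-last j) (sym (hub-next j))
            (proj₁ (proj₂ (triangle-edges {last j} last<))))
    where
    last< : last j < n''
    last< = <-trans (n<1+n (last j)) (subst (_< n'') (sym (suc-last j)) (≤-<-trans (m≤n+m (suc j * K) K) fits))

  labVertex-distinct : ∀ {t t'} → t < t' → t' < n → lab (vertex t) ≢ lab (vertex t')
  labVertex-distinct t<t' t'<n e =
    vertex-distinct t<t' t'<n (lab-injective (vertex<n (<-trans t<t' t'<n)) (vertex<n t'<n) e)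

  ∧-false : ∀ {x y} → x ∧ y ≡ false → x ≡ false ⊎ y ≡ false
  ∧-false {false} _ = inj₁ refl
  ∧-false {true}  e = inj₂ e

  module Degree (S : Subset n) (deg : InducedMaxDegree≤ H S K) where

    missing : ℕ → Bool
    missing t = does (lab (vertex t) ∈? ∁ S)

    present : ∀ {t} → missing t ≡ false → lab (vertex t) ∈ S
    present {t} e with lab (vertex t) ∈? ∁ S
    ... | no ∉∁S = x∉∁p⇒x∈p ∉∁S

    missing≤∁ : ∀ {L} → L ≤ n → count missing L ≤ ∣ ∁ S ∣
    missing≤∁ {L} L≤n = subst (_≤ ∣ ∁ S ∣) (length-filter-applyUpTo (_∈? ∁ S) (lab ∘ vertex) L)
      (unique⊆⇒length≤ (Unique.filter⁺ (_∈? ∁ S) (Unique.applyUpTo⁺₁ (lab ∘ vertex) L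
                                                    (λ t<t' t'<L → labVertex-distinct t<t' (<-≤-trans t'<L L≤n))))
                        (all-filter (_∈? ∁ S) (applyUpTo (lab ∘ vertex) L)))

    open Blocks K (missing ∘ suc) (missing 0) public

    inBlock : ∀ {i r} → block i ≡ 0 → r < K → lab (vertex (suc (i * K + r))) ∈ S
    inBlock {i} {r} empty r<K = present {suc (i * K + r)} (count≡0⇒false (missing ∘ suc ∘ (i * K +_)) empty r<K)

    -- If its block lies in S, the hub has K - 1 neighbours in S there; one more on each side makes K + 1.
    overfull : ∀ {i} → suc i * K < n'' → block i ≡ 0 → ∀ {tl tr} →
               tl ≤ i * K → suc (suc (last i)) ≤ tr → tr ≤ suc (suc (suc i * K)) →
               lab (vertex tl) ∈ S → Edge H (lab (hub i)) (lab (vertex tl)) →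
               lab (vertex tr) ∈ S → Edge H (lab (hub i)) (lab (vertex tr)) → ⊥
    overfull {i} fits empty {tl} {tr} tl≤ ≤tr tr≤ tl∈S hub-tl tr∈S hub-tr =
      1+n≰n (begin
        suc K                                    ≡⟨ cong (suc ∘ suc) (length-applyUpTo interiorVertex (2 + k)) ⟨
        length (lab (vertex tl) ∷ lab (vertex tr) ∷ interior)  ≤⟨ unique⊆⇒length≤ unique inNbhd ⟩
        ∣ nbhd H (lab (hub i)) ∩ S ∣             ≤⟨ deg (lab (hub i)) hub∈S ⟩
        K                                        ∎)
      where
      open ≤-Reasoning
      interiorVertex : ℕ → Fin n
      interiorVertex j = lab (apex (i * K + j))
      interior : List (Fin n)
      interior = applyUpTo interiorVertex (2 + k)
      apex∈S : ∀ {j} → j < 2 + k → lab (apex (i * K + j)) ∈ S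
      apex∈S {j} j< = subst (λ t → lab (vertex (suc t)) ∈ S) (+-suc (i * K) j) (inBlock {i} {suc j} empty (s≤s j<))
      hub∈S : lab (hub i) ∈ S
      hub∈S = subst (λ t → lab t ∈ S) (sym (hub-vertex i))
                (subst (λ t → lab (vertex (suc t)) ∈ S) (+-identityʳ (i * K)) (inBlock {i} {0} empty z<s))
      inNbhd : All (_∈ nbhd H (lab (hub i)) ∩ S) (lab (vertex tl) ∷ lab (vertex tr) ∷ interior)
      inNbhd = ∈-nbhd H S hub-tl tl∈S ∷ ∈-nbhd H S hub-tr tr∈S ∷
               applyUpTo⁺₁ interiorVertex (2 + k) (λ j< → ∈-nbhd H S (hub-apex (m<n⇒m<1+n j<)) (apex∈S j<))
        where open Fan i fits
      tr<n : tr < n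
      tr<n = ≤-<-trans tr≤ (s≤s (s≤s fits))
      interior< : ∀ {j} → j < 2 + k → suc (suc (i * K + j)) < tr
      interior< j< = <-≤-trans (s≤s (s≤s (+-monoʳ-< (i * K) j<))) ≤tr
      tl<interior : ∀ {j} → tl < suc (suc (i * K + j))
      tl<interior = s≤s (≤-trans tl≤ (m≤n⇒m≤1+n (m≤m+n _ _)))
      distinct : ∀ {t t'} → t < t' → t' ≤ tr → lab (vertex t) ≢ lab (vertex t')
      distinct t<t' t'≤tr = labVertex-distinct t<t' (≤-<-trans t'≤tr tr<n)
      unique : Unique (lab (vertex tl) ∷ lab (vertex tr) ∷ interior)
      unique = (distinct (<-trans tl<interior (interior< {0} z<s)) ≤-refl
                ∷ applyUpTo⁺₁ interiorVertex (2 + k) (λ j< → distinct tl<interior (<⇒≤ (interior< j<))))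
             ∷ (applyUpTo⁺₁ interiorVertex (2 + k) (λ j< → distinct (interior< j<) ≤-refl ∘ sym)
             ∷ Unique.applyUpTo⁺₁ interiorVertex (2 + k)
                 (λ j<j' j'< → distinct (s≤s (s≤s (+-monoʳ-< (i * K) j<j'))) (<⇒≤ (interior< j'<))))

    Neighbour : ℕ → ℕ → Set
    Neighbour i t = lab (vertex t) ∈ S × Edge H (lab (hub i)) (lab (vertex t))

    leftNeighbour : ∀ {i} → suc i * K < n'' → leftPair i ≡ false → ∃ λ t → t ≤ i * K × Neighbour i t
    leftNeighbour {zero} fits e = 0 , z≤n , present {0} e , Fan.hub-mover 0 fits
    leftNeighbour {suc j} fits e with ∧-false e
    ... | inj₁ e₁ = suc (j * K) , s≤s (m≤n+m (j * K) (2 + k)) , present {suc (j * K)} e₁ ,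
                    subst (λ v → Edge H (lab (hub (suc j))) (lab v)) (trans (mover-next j) (hub-vertex j))
                          (Fan.hub-mover (suc j) fits)
    ... | inj₂ e₂ = suc (last j) , ≤-reflexive (suc-last j) , present {suc (last j)} e₂ ,
                    subst (λ t → Edge H (lab (hub (suc j))) (lab (vertex (suc t)))) (sym (+-suc (j * K) (1 + k)))
                          (hub-previousApex j fits)

    rightNeighbour : ∀ {i} → suc i * K < n'' → rightPair i ≡ false →
                     ∃ λ t → suc (suc (last i)) ≤ t × t ≤ suc (suc (suc i * K)) × Neighbour i t
    rightNeighbour {i} fits e with ∧-false e
    ... | inj₁ e₁ = suc (suc i * K) , ≤-reflexive (cong suc (suc-last i)) , n≤1+n _ ,
                    present {suc (suc i * K)} e₁ ,
                    subst (λ t → Edge H (lab (hub i)) (lab (vertex (suc t)))) (suc-last i) (Fan.hub-apex i fits ≤-refl)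
    ... | inj₂ e₂ = suc (suc i * K + 1) ,
                    ≤-trans (≤-reflexive (cong suc (suc-last i))) (≤-trans (n≤1+n _) (≤-reflexive (sym plusOne))) ,
                    ≤-reflexive plusOne , present {suc (suc i * K + 1)} e₂ ,
                    subst (λ t → Edge H (lab (hub i)) (lab (vertex t))) (sym plusOne) (Fan.hub-nextApex i fits)
      where
      plusOne : suc (suc i * K + 1) ≡ suc (suc (suc i * K))
      plusOne = cong suc (+-comm (suc i * K) 1)

    flanked : ∀ i → suc i * K < n'' → Flanked i
    flanked i fits empty with leftPair i in eL | rightPair i in eR
    ... | true  | _    = inj₁ refl
    ... | false | true = inj₂ refl
    ... | false | false with leftNeighbour {i} fits eL | rightNeighbour {i} fits eR
    ...   | tl , tl≤ , tl∈S , hub-tl | tr , ≤tr , tr≤ , tr∈S , hub-tr =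
      ⊥-elim (overfull {i} fits empty tl≤ ≤tr tr≤ tl∈S hub-tl tr∈S hub-tr)

    blockCount : ℕ
    blockCount = (n'' ∸ 1) / K

    blockCount*K≤ : blockCount * K ≤ n'' ∸ 1
    blockCount*K≤ = m/n*n≤m (n'' ∸ 1) K

    blockCount-fit : ∀ {i} → i < blockCount → suc i * K < n''
    blockCount-fit {i} i<G = ≤pred⇒< (≤-trans (*-monoˡ-≤ K i<G) blockCount*K≤) z<s
      where
      ≤pred⇒< : ∀ {x m} → x ≤ m ∸ 1 → 0 < x → x < m
      ≤pred⇒< {m = zero}  x≤0 0<x = contradiction x≤0 (<⇒≱ 0<x)
      ≤pred⇒< {m = suc m} x≤m _   = s≤s x≤m

    blocks≤missing : blockCount ≤ ∣ ∁ S ∣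
    blocks≤missing =
      ≤-trans (blocks≤count (s≤s (s≤s (s≤s z≤n))) blockCount (λ i i< → flanked i (blockCount-fit i<)))
              (missing≤∁ {suc (suc (blockCount * K))} (s≤s (s≤s (≤-trans blockCount*K≤ (m∸n≤m n'' 1)))))

    degree-bound : n ≤ K * ∣ ∁ S ∣ + 2 * K
    degree-bound = begin
      suc (suc n'')                    ≤⟨ s≤s (s≤s (m≤[1+[m∸1]/n]*n n'' K)) ⟩
      2 + (K + blockCount * K)             ≤⟨ +-monoˡ-≤ (K + blockCount * K) (s≤s (s≤s (z≤n {1 + k}))) ⟩
      K + (K + blockCount * K)             ≡⟨ rearrange K blockCount ⟩
      K * blockCount + 2 * K               ≤⟨ +-monoˡ-≤ (2 * K) (*-monoʳ-≤ K blocks≤missing) ⟩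
      K * ∣ ∁ S ∣ + 2 * K              ∎
      where
      open ≤-Reasoning
      rearrange : ∀ K b → K + (K + b * K) ≡ K * b + 2 * K
      rearrange = solve-∀

point : Graph 1
point = record { adj = λ _ _ → false ; sym = λ _ _ → refl ; irrefl = λ _ → refl }

point-maximalOuterpath : MaximalOuterpath point
point-maximalOuterpath = ((id , id , λ _ _ _ _ ()) , λ { Fin.zero Fin.zero z≢z → ⊥-elim (z≢z refl) }) ,
  (0 , (λ ()) , (λ { {()} }) , (λ ()) , (λ { (Fin.zero , Fin.zero , Fin.zero) (() , _) }) , λ ())

missing⇒bound : ∀ K {n s} → s ≤ n → n ≤ suc K * (n ∸ s) + 2 * suc K → suc K * s ≤ K * n + 2 * suc K
missing⇒bound K {n} {s} s≤n h = +-cancelʳ-≤ n (suc K * s) (K * n + 2 * suc K) (begin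
  suc K * s + n                              ≤⟨ +-monoʳ-≤ (suc K * s) h ⟩
  suc K * s + (suc K * (n ∸ s) + 2 * suc K)   ≡⟨ sym (+-assoc (suc K * s) _ _) ⟩
  suc K * s + suc K * (n ∸ s) + 2 * suc K     ≡⟨ cong (_+ 2 * suc K) (sym (*-distribˡ-+ (suc K) s (n ∸ s))) ⟩
  suc K * (s + (n ∸ s)) + 2 * suc K           ≡⟨ cong (λ m → suc K * m + 2 * suc K) (m+[n∸m]≡n s≤n) ⟩
  suc K * n + 2 * suc K                       ≡⟨ rearrange K n ⟩
  K * n + 2 * suc K + n                       ∎)
  where
  open ≤-Reasoning
  rearrange : ∀ K n → suc K * n + 2 * suc K ≡ K * n + 2 * suc K + n
  rearrange = solve-∀

theorem1 : (n k : ℕ) → 1 ≤ n → 3 ≤ k →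
    Σ (Graph n) λ G → Outerpath G ×
    ((I : Subset n) → InducedMaxDegree≤ G I k →
    k * ∣ I ∣ ≤ (k ∸ 1) * n + 2 * k)
theorem1 (suc zero) k _ _ = point , (1 , point , point-maximalOuterpath , id , id , λ _ _ e → e) ,
  λ S _ → ≤-trans (*-monoʳ-≤ k (∣p∣≤n S)) (≤-trans (≤-reflexive (*-identityʳ k))
                                                    (≤-trans (m≤m+n k (k + 0)) (m≤n+m (2 * k) ((k ∸ 1) * 1))))
theorem1 (suc (suc n'')) (suc (suc (suc k))) _ _ =
  H , (_ , H , maximalOuterpath , id , id , λ _ _ e → e) ,
  λ S deg → missing⇒bound (2 + k) (∣p∣≤n S)
              (subst (λ m → _ ≤ (3 + k) * m + _) (∣∁p∣≡n∸∣p∣ S) (Degree.degree-bound S deg))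
  where open Zigzag k n''
theorem1 (suc (suc _)) (suc zero)       _ (s≤s ())
theorem1 (suc (suc _)) (suc (suc zero)) _ (s≤s (s≤s ()))
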